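{- Let $n$ be an even positive integer, $p\in[0,1]$, and $t\ge0$ an even integer. Then $$\left\|P^{*t}-U\right\|_{TV}\ge\frac12(1-2p)^{tn/2}.$$ Moreover, if $0<p\le\frac14$ and $t\le\frac{1}{n^2p}$, then $\left\|P^{*t}-U\right\|_{TV}\ge\frac12-\frac1n$.
   Context: Involution walk: for $n$ even and $p\in[0,1]$, $P$ is the probability measure on $S_n$ obtained by choosing a uniformly random perfect matching of $\{1,\dots,n\}$, keeping each of its $n/2$ transpositions independently with probability $1-p$, and outputting the product of the kept transpositions (an involution with $s$ two-cycles is chosen with total probability $\binom{n/2}{s}p^{n/2-s}(1-p)^s$, uniformly within its conjugacy class). $P^{*t}$ is the $t$-fold convolution (law after $t$ steps from the identity), $U$ the uniform distribution on $S_n$, and $\|\mu-\nu\|_{TV}=\max_{A\subseteq S_n}|\mu(A)-\nu(A)|$.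
   Formalization: The parameter p is taken over the rationals in $[0,1]$. -}

module Defs where

open import Data.Bool using (Bool; true; false; _∧_; _∨_; not; if_then_else_)
open import Data.Nat as ℕ using (ℕ; zero; suc; _!)
open import Data.Nat.Combinatorics using (_C_)
open import Data.Integer using (+_)
open import Data.Fin as Fin using (Fin)
open import Data.Vec as Vec using (Vec; []; _∷_; lookup; tabulate)
open import Data.Vec.Properties using (≡-dec)
open import Data.List as List using (List; []; _∷_; filter; length; allFin; concatMap; foldr)
open import Data.Rational as ℚ using (ℚ; 0ℚ; 1ℚ; _+_; _*_; _-_; ∣_∣; _⊔_; _/_)
open import Relation.Nullary.Decidable using (⌊_⌋)
open import Relation.Binary.PropositionalEquality using (_≡_)

ℕtoℚ : ℕ → ℚ
ℕtoℚ k = + k / 1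

-- 1/k for k ≠ 0 (and 0 for k = 0; only ever used with k ≠ 0)
recipℕ : ℕ → ℚ
recipℕ zero    = 0ℚ
recipℕ (suc k) = + 1 / suc k

_^ℚ_ : ℚ → ℕ → ℚ
q ^ℚ zero  = 1ℚ
q ^ℚ suc k = q * (q ^ℚ k)

-- The symmetric group S_n, elements represented as the vector of images
-- (σ(0), …, σ(n-1)); S_n is the list of all injective such vectors.

Word : ℕ → Set
Word n = Vec (Fin n) n

allVecs : (n k : ℕ) → List (Vec (Fin n) k)
allVecs n zero    = [] ∷ []
allVecs n (suc k) = concatMap (λ i → List.map (i ∷_) (allVecs n k)) (allFin n)

_==_ : ∀ {n} → Fin n → Fin n → Bool
i == j = ⌊ i Fin.≟ j ⌋

allB : ∀ {n} → (Fin n → Bool) → Bool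
allB f = foldr (λ i b → f i ∧ b) true (allFin _)

countB : ∀ {n} → (Fin n → Bool) → ℕ
countB f = length (filter (λ i → Data.Bool._≟_ (f i) true) (allFin _))
  where import Data.Bool

isPerm : ∀ {n} → Word n → Bool
isPerm σ = allB (λ i → allB (λ j → (i == j) ∨ not (lookup σ i == lookup σ j)))

Sym : (n : ℕ) → List (Word n)
Sym n = filter (λ σ → Data.Bool._≟_ (isPerm σ) true) (allVecs n n)
  where import Data.Bool

idPerm : ∀ {n} → Word n
idPerm = tabulate (λ i → i)

_∘ₚ_ : ∀ {n} → Word n → Word n → Word n
σ ∘ₚ τ = tabulate (λ i → lookup σ (lookup τ i))

_=ₚ_ : ∀ {n} → Word n → Word n → Bool
σ =ₚ τ = ⌊ ≡-dec Fin._≟_ σ τ ⌋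

Measure : ℕ → Set
Measure n = Word n → ℚ

sumℚ : List ℚ → ℚ
sumℚ = foldr _+_ 0ℚ

mass : ∀ {n} → Measure n → List (Word n) → ℚ
mass μ A = sumℚ (List.map μ A)

conv : ∀ {n} → Measure n → Measure n → Measure n
conv {n} μ ν σ =
  sumℚ (concatMap (λ α → List.map (λ β → if (α ∘ₚ β) =ₚ σ then μ α * ν β else 0ℚ) (Sym n)) (Sym n))

δid : ∀ {n} → Measure n
δid σ = if σ =ₚ idPerm then 1ℚ else 0ℚ

convPow : ∀ {n} → Measure n → ℕ → Measure n
convPow μ zero    = δid
convPow μ (suc t) = conv (convPow μ t) μ

sublists : ∀ {A : Set} → List A → List (List A)
sublists []       = [] ∷ []
sublists (x ∷ xs) = let r = sublists xs in List.map (x ∷_) r List.++ r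

tv : ∀ {n} → Measure n → Measure n → ℚ
tv {n} μ ν = foldr (λ A m → ∣ mass μ A - mass ν A ∣ ⊔ m) 0ℚ (sublists (Sym n))

uniform : ∀ {n} → Measure n
uniform {n} σ = recipℕ (n !)

isInvolution : ∀ {n} → Word n → Bool
isInvolution σ = allB (λ i → lookup σ (lookup σ i) == i)

twoCycles : ∀ {n} → Word n → ℕ
twoCycles σ = countB (λ i → not (lookup σ i == i)) ℕ./ 2

classSize : (n s : ℕ) → ℕ
classSize n s = length (filter (λ τ → Data.Bool._≟_ (isInvolution τ ∧ ⌊ twoCycles τ ℕ.≟ s ⌋) true) (Sym n))
  where import Data.Bool

involutionWalk : (n : ℕ) → ℚ → Measure n
involutionWalk n p σ =
  if isInvolution σ
  then ℕtoℚ ((n ℕ./ 2) C s) * (p ^ℚ (n ℕ./ 2 ℕ.∸ s)) * ((1ℚ - p) ^ℚ s) * recipℕ (classSize n s)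
  else 0ℚ
  where s = twoCycles σ

-- The sign character χ σ = (−1)^(inversions of σ) is multiplicative on S_n, so the sign
-- expectation 𝔼χ μ = Σ_σ μ(σ) χ(σ) turns convolution into multiplication: 𝔼χ (P^{*t}) = (𝔼χ P)^t.
-- An involution with s two-cycles has sign (−1)^s, so the binomial theorem gives
-- 𝔼χ P = (p − (1 − p))^{n/2}, and 𝔼χ (P^{*t}) = (1 − 2p)^{tn/2} for even t. The uniform law has
-- 𝔼χ U = 0, and comparing P^{*t} with U on the even and on the odd permutations yields
-- 2 ‖P^{*t} − U‖_TV ≥ 𝔼χ (P^{*t}). For the second bound, Bernoulli's inequality gives
-- (1 − 2p)^{tn/2} ≥ 1 − tnp ≥ 1 − 1/n.
module Submission where

open import Algebra.Bundles using (CommutativeMonoid; CommutativeSemiring; CommutativeRing)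
open import Data.Bool using (Bool; true; false; if_then_else_; not; _∧_; _∨_; T)
open import Data.Bool.Properties using (∨-identityʳ)
import Data.Bool as Bool
open import Data.Fin as Fin using (Fin; zero; suc; toℕ; fromℕ<; punchOut)
open import Data.Fin.Permutation using (Permutation; permutation)
import Data.Fin.Properties as Fin
open import Data.Fin.Properties using (any?; injective⇒≤; punchOut-injective; punchInᵢ≢i; <-cmp; <-asym; _<?_; <⇒≢)
open import Data.List as List using (List; []; _∷_; _++_; filter; length; foldr; concatMap; allFin)
import Data.List.Properties as List
open import Data.List.Membership.Propositional using (_∈_)
open import Data.List.Membership.Propositional.Properties using (∈-allFin; ∈-filter⁺; ∈-filter⁻; ∈-concat⁺′; ∈-map⁺; ∈-++⁺ˡ; ∈-++⁺ʳ)
open import Data.List.Relation.Unary.Any using (here; there)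
import Data.Nat as ℕ
open import Data.Nat using (ℕ; zero; suc; s≤s; z≤n; _!; _∸_)
open import Data.Nat.Combinatorics using (_C_)
open import Data.Nat.Divisibility using (_∣_; divides; ∣⇒≤; ∣n⇒∣m*n)
import Data.Nat.DivMod as ℕ
import Data.Nat.Properties as ℕ
open import Data.Product using (∃; _×_; _,_; proj₁; proj₂)
open import Data.Sum using (inj₁; inj₂)
open import Data.Unit using (tt)
open import Data.Vec as Vec using (Vec; []; _∷_; lookup; tabulate)
open import Data.Vec.Properties using (≡-dec; lookup∘tabulate; tabulate∘lookup; tabulate-cong)
open import Function using (_∘_)
open import Function.Definitions using (Injective)
open import Relation.Binary using (tri<; tri≈; tri>)
open import Relation.Binary.PropositionalEquality using (_≡_; _≢_; refl; sym; trans; cong; cong₂; subst; subst₂; module ≡-Reasoning)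
open import Relation.Nullary using (yes; no; ¬_; contradiction)
open import Relation.Nullary.Decidable using (Dec; ⌊_⌋; dec-true; dec-false; isYes≗does; toWitness)
open import Defs

private variable n : ℕ

injective⇒surjective : {f : Fin n → Fin n} → Injective _≡_ _≡_ f → ∀ y → ∃ λ x → f x ≡ y
injective⇒surjective {suc n} {f} f-inj y with any? (λ x → f x Fin.≟ y)
... | yes hit  = hit
... | no  miss = contradiction (injective⇒≤ punchOut∘f-injective) ℕ.1+n≰n
  where
  y≢f : ∀ x → y ≢ f x
  y≢f x y≡fx = miss (x , sym y≡fx)
  punchOut∘f-injective : Injective _≡_ _≡_ (λ x → punchOut (y≢f x))
  punchOut∘f-injective = f-inj ∘ punchOut-injective (y≢f _) (y≢f _)

injective⇒permutation : (f : Fin n → Fin n) → Injective _≡_ _≡_ f → Permutation n n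
injective⇒permutation f f-inj = permutation f f⁻¹ (λ y → proj₂ (onto y)) (λ x → f-inj (proj₂ (onto (f x))))
  where
  onto = injective⇒surjective f-inj
  f⁻¹ : Fin _ → Fin _
  f⁻¹ y = proj₁ (onto y)

module FinSum {c ℓ} (M : CommutativeMonoid c ℓ) where
  private module M = CommutativeMonoid M
  open M using (Carrier; _≈_; _∙_; ∙-congˡ; identityʳ; setoid) renaming (ε to 0#)
  open import Algebra.Properties.CommutativeMonoid.Sum M public

  sum-zero : ∀ {n} (f : Fin n → Carrier) → (∀ i → f i ≈ 0#) → sum f ≈ 0#
  sum-zero {n} f f≈0 = M.trans (sum-cong-≋ f≈0) (sum-replicate-zero n)

  sum-single : ∀ {n} (f : Fin n → Carrier) (i : Fin n) → (∀ j → j ≢ i → f j ≈ 0#) → sum f ≈ f i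
  sum-single {suc n} f i f-vanishes = begin
    sum f                                ≈⟨ sum-remove f ⟩
    f i ∙ sum (Vector.removeAt f i)      ≈⟨ ∙-congˡ (sum-zero (Vector.removeAt f i) (λ k → f-vanishes _ (punchInᵢ≢i i k))) ⟩
    f i ∙ 0#                              ≈⟨ identityʳ (f i) ⟩
    f i                                   ∎
    where
    open import Relation.Binary.Reasoning.Setoid setoid
    import Data.Vec.Functional as Vector

  sum-reindex : ∀ {n} (f : Fin n → Fin n) → Injective _≡_ _≡_ f → (g : Fin n → Carrier) → sum (g ∘ f) ≈ sum g
  sum-reindex f f-inj g = M.sym (∑-permute g (injective⇒permutation f f-inj))

⌊⌋-true : {A : Set} (a? : Dec A) → A → ⌊ a? ⌋ ≡ true
⌊⌋-true a? a = trans (isYes≗does a?) (dec-true a? a)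

⌊⌋-false : {A : Set} (a? : Dec A) → ¬ A → ⌊ a? ⌋ ≡ false
⌊⌋-false a? ¬a = trans (isYes≗does a?) (dec-false a? ¬a)

⌊⌋-sound : {A : Set} (a? : Dec A) → ⌊ a? ⌋ ≡ true → A
⌊⌋-sound a? a?≡true = toWitness {a? = a?} (subst T (sym a?≡true) tt)

==-≡ : {i j : Fin n} → i ≡ j → (i == j) ≡ true
==-≡ = ⌊⌋-true (_ Fin.≟ _)

==-≢ : {i j : Fin n} → i ≢ j → (i == j) ≡ false
==-≢ = ⌊⌋-false (_ Fin.≟ _)

==⇒≡ : {i j : Fin n} → (i == j) ≡ true → i ≡ j
==⇒≡ = ⌊⌋-sound (_ Fin.≟ _)

==-comm : (i j : Fin n) → (i == j) ≡ (j == i)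
==-comm i j with i Fin.≟ j
... | yes i≡j = sym (==-≡ (sym i≡j))
... | no  i≢j = sym (==-≢ (i≢j ∘ sym))

==-injective : {m : ℕ} {f : Fin m → Fin n} → Injective _≡_ _≡_ f → (i j : Fin m) → (f i == f j) ≡ (i == j)
==-injective f-inj i j with i Fin.≟ j
... | yes i≡j = ==-≡ (cong _ i≡j)
... | no  i≢j = ==-≢ (i≢j ∘ f-inj)

_<ᵇ_ : Fin n → Fin n → Bool
i <ᵇ j = ⌊ i <? j ⌋

<ᵇ-true : {i j : Fin n} → i Fin.< j → (i <ᵇ j) ≡ true
<ᵇ-true = ⌊⌋-true (_ <? _)

<ᵇ-false : {i j : Fin n} → ¬ i Fin.< j → (i <ᵇ j) ≡ false
<ᵇ-false = ⌊⌋-false (_ <? _)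

module _ {A : Set} (p : A → Bool) where

  all-true⁻ : ∀ xs → foldr (λ x b → p x ∧ b) true xs ≡ true → ∀ {x} → x ∈ xs → p x ≡ true
  all-true⁻ (y ∷ ys) all-true x∈ with p y in py
  all-true⁻ (y ∷ ys) all-true (here refl) | true = py
  all-true⁻ (y ∷ ys) all-true (there x∈)  | true = all-true⁻ ys all-true x∈

  all-true⁺ : ∀ xs → (∀ x → p x ≡ true) → foldr (λ x b → p x ∧ b) true xs ≡ true
  all-true⁺ []       _      = refl
  all-true⁺ (y ∷ ys) p-true rewrite p-true y = all-true⁺ ys p-true

allB⁻ : {f : Fin n → Bool} → allB f ≡ true → ∀ i → f i ≡ true
allB⁻ {f = f} all-true i = all-true⁻ f (allFin _) all-true (∈-allFin i)

allB⁺ : {f : Fin n → Bool} → (∀ i → f i ≡ true) → allB f ≡ true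
allB⁺ {f = f} = all-true⁺ f (allFin _)

isPerm⇒injective : {σ : Word n} → isPerm σ ≡ true → Injective _≡_ _≡_ (lookup σ)
isPerm⇒injective {σ = σ} σ-perm {i} {j} σi≡σj = ==⇒≡ (begin
  i == j                                      ≡⟨ sym (∨-identityʳ (i == j)) ⟩
  (i == j) ∨ not true                         ≡⟨ cong (λ b → (i == j) ∨ not b) (sym (==-≡ σi≡σj)) ⟩
  (i == j) ∨ not (lookup σ i == lookup σ j)   ≡⟨ allB⁻ (allB⁻ σ-perm i) j ⟩
  true                                        ∎)
  where open ≡-Reasoning

injective⇒isPerm : {σ : Word n} → Injective _≡_ _≡_ (lookup σ) → isPerm σ ≡ true
injective⇒isPerm {σ = σ} σ-inj = allB⁺ (λ i → allB⁺ (λ j → distinct-images i j))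
  where
  distinct-images : ∀ i j → ((i == j) ∨ not (lookup σ i == lookup σ j)) ≡ true
  distinct-images i j with i Fin.≟ j
  ... | yes _   = refl
  ... | no  i≢j rewrite ==-≢ (i≢j ∘ σ-inj) = refl

isInvolution⇒involutive : {σ : Word n} → isInvolution σ ≡ true → ∀ i → lookup σ (lookup σ i) ≡ i
isInvolution⇒involutive σ-invol i = ==⇒≡ (allB⁻ σ-invol i)

lookup-∘ₚ : (α β : Word n) (i : Fin n) → lookup (α ∘ₚ β) i ≡ lookup α (lookup β i)
lookup-∘ₚ α β = lookup∘tabulate _

isPerm-∘ₚ : {α β : Word n} → isPerm α ≡ true → isPerm β ≡ true → isPerm (α ∘ₚ β) ≡ true
isPerm-∘ₚ {α = α} {β} α-perm β-perm = injective⇒isPerm {σ = α ∘ₚ β} (λ {i} {j} αβi≡αβj →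
  isPerm⇒injective {σ = β} β-perm (isPerm⇒injective {σ = α} α-perm (trans (sym (lookup-∘ₚ α β i)) (trans αβi≡αβj (lookup-∘ₚ α β j)))))

∈-allVecs : ∀ {n} k (x : Vec (Fin n) k) → x ∈ allVecs n k
∈-allVecs zero    []      = here refl
∈-allVecs (suc k) (a ∷ x) = ∈-concat⁺′ (∈-map⁺ (a ∷_) (∈-allVecs k x)) (∈-map⁺ _ (∈-allFin a))

isPerm⇒∈-Sym : {σ : Word n} → isPerm σ ≡ true → σ ∈ Sym n
isPerm⇒∈-Sym {n} {σ} σ-perm = ∈-filter⁺ (λ σ → isPerm σ Bool.≟ true) (∈-allVecs n σ) σ-perm

∈-Sym⇒isPerm : {σ : Word n} → σ ∈ Sym n → isPerm σ ≡ true
∈-Sym⇒isPerm {n} σ∈ = proj₂ (∈-filter⁻ (λ σ → isPerm σ Bool.≟ true) {xs = allVecs n n} σ∈)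

=ₚ-refl : (σ : Word n) → (σ =ₚ σ) ≡ true
=ₚ-refl σ = ⌊⌋-true (≡-dec Fin._≟_ σ σ) refl

=ₚ-≢ : {u v : Word n} → u ≢ v → (u =ₚ v) ≡ false
=ₚ-≢ = ⌊⌋-false (≡-dec Fin._≟_ _ _)

module Counting where
  open import Data.Nat using (_+_; _*_; _≤_; _≟_)
  open import Data.Nat.Properties using (*-zeroʳ; *-identityʳ; +-0-commutativeMonoid; +-*-semiring; *-distribˡ-+; *-distribʳ-+; +-identityʳ; *-cancelˡ-≡; *-assoc; *-comm; +-comm; +-assoc; *-suc; +-suc; ≤-pred; ≤-trans; ≤-reflexive)
  open import Data.Nat.DivMod using (_/_; m*n/n≡m; /-monoˡ-≤)
  open FinSum +-0-commutativeMonoid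
  open import Algebra.Properties.Semiring.Sum +-*-semiring using (*-distribˡ-sum)
  open import Data.Nat.Solver using (module +-*-Solver)
  open +-*-Solver using (solve; _:*_; _:=_)

  private variable f g : Fin n → Fin n → ℕ

  𝟙 : Bool → ℕ
  𝟙 b = if b then 1 else 0

  ∑∑ : (Fin n → Fin n → ℕ) → ℕ
  ∑∑ {n} f = ∑[ i < n ] ∑[ j < n ] f i j

  ∑∑-cong : (∀ i j → f i j ≡ g i j) → ∑∑ f ≡ ∑∑ g
  ∑∑-cong f≗g = sum-cong-≗ (λ i → sum-cong-≗ (f≗g i))

  ∑∑-distrib-+ : (f g : Fin n → Fin n → ℕ) → ∑∑ (λ i j → f i j + g i j) ≡ ∑∑ f + ∑∑ g
  ∑∑-distrib-+ {n} f g = trans (sum-cong-≗ (λ i → ∑-distrib-+ (f i) (g i))) (∑-distrib-+ (λ i → ∑[ j < n ] f i j) (λ i → ∑[ j < n ] g i j))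

  ∑∑-*ˡ : (c : ℕ) (f : Fin n → Fin n → ℕ) → ∑∑ (λ i j → c * f i j) ≡ c * ∑∑ f
  ∑∑-*ˡ {n} c f = trans (sum-cong-≗ (λ i → sym (*-distribˡ-sum c (f i)))) (sym (*-distribˡ-sum c (λ i → ∑[ j < n ] f i j)))

  ∑∑-transpose : (f : Fin n → Fin n → ℕ) → ∑∑ (λ i j → f j i) ≡ ∑∑ f
  ∑∑-transpose f = ∑-comm (λ i j → f j i)

  ∑∑-reindex : {γ : Fin n → Fin n} → Injective _≡_ _≡_ γ → (f : Fin n → Fin n → ℕ) → ∑∑ (λ i j → f (γ i) (γ j)) ≡ ∑∑ f
  ∑∑-reindex {γ = γ} γ-inj f =
    trans (sum-cong-≗ (λ i → sum-reindex γ γ-inj (f (γ i)))) (sum-reindex γ γ-inj (λ x → ∑[ j < _ ] f x j))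

  ∑< : (Fin n → Fin n → ℕ) → ℕ
  ∑< H = ∑∑ (λ i j → 𝟙 (i <ᵇ j) * H i j)

  ∑<-cong : {H G : Fin n → Fin n → ℕ} → (∀ {i j} → i Fin.< j → H i j ≡ G i j) → ∑< H ≡ ∑< G
  ∑<-cong {H = H} {G} H≗G = ∑∑-cong pointwise
    where
    pointwise : ∀ i j → 𝟙 (i <ᵇ j) * H i j ≡ 𝟙 (i <ᵇ j) * G i j
    pointwise i j with i <? j
    ... | yes i<j = cong (_+ 0) (H≗G i<j)
    ... | no  _   = refl

  ∑<-distrib-+ : (H G : Fin n → Fin n → ℕ) → ∑< (λ i j → H i j + G i j) ≡ ∑< H + ∑< G
  ∑<-distrib-+ H G = trans (∑∑-cong (λ i j → *-distribˡ-+ (𝟙 (i <ᵇ j)) (H i j) (G i j))) (∑∑-distrib-+ (λ i j → 𝟙 (i <ᵇ j) * H i j) (λ i j → 𝟙 (i <ᵇ j) * G i j))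

  ∑<-*ˡ : (c : ℕ) (H : Fin n → Fin n → ℕ) → ∑< (λ i j → c * H i j) ≡ c * ∑< H
  ∑<-*ˡ c H = trans (∑∑-cong (λ i j → x*[y*z]≡y*[x*z] (𝟙 (i <ᵇ j)) c (H i j))) (∑∑-*ˡ c (λ i j → 𝟙 (i <ᵇ j) * H i j))
    where
    x*[y*z]≡y*[x*z] : ∀ x y z → x * (y * z) ≡ y * (x * z)
    x*[y*z]≡y*[x*z] x y z = trans (sym (*-assoc x y z)) (trans (cong (_* z) (*-comm x y)) (*-assoc y x z))

  ≢-split : (i j : Fin n) → 𝟙 (not (i == j)) ≡ 𝟙 (i <ᵇ j) + 𝟙 (j <ᵇ i)
  ≢-split i j with <-cmp i j
  ... | tri< i<j i≢j j≮i rewrite ==-≢ i≢j | <ᵇ-true i<j | <ᵇ-false j≮i = refl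
  ... | tri≈ i≮j i≡j j≮i rewrite ==-≡ i≡j | <ᵇ-false i≮j | <ᵇ-false j≮i = refl
  ... | tri> i≮j i≢j j<i rewrite ==-≢ i≢j | <ᵇ-false i≮j | <ᵇ-true j<i = refl

  ∑≢≡2*∑< : (H : Fin n → Fin n → ℕ) → (∀ x y → H x y ≡ H y x) → ∑∑ (λ i j → 𝟙 (not (i == j)) * H i j) ≡ 2 * ∑< H
  ∑≢≡2*∑< H H-sym = begin
    ∑∑ (λ i j → 𝟙 (not (i == j)) * H i j)
      ≡⟨ ∑∑-cong (λ i j → trans (cong (_* H i j) (≢-split i j)) (*-distribʳ-+ (H i j) (𝟙 (i <ᵇ j)) _)) ⟩
    ∑∑ (λ i j → 𝟙 (i <ᵇ j) * H i j + 𝟙 (j <ᵇ i) * H i j)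
      ≡⟨ ∑∑-distrib-+ (λ i j → 𝟙 (i <ᵇ j) * H i j) (λ i j → 𝟙 (j <ᵇ i) * H i j) ⟩
    ∑< H + ∑∑ (λ i j → 𝟙 (j <ᵇ i) * H i j)
      ≡⟨ cong (∑< H +_) (trans (∑∑-transpose (λ i j → 𝟙 (i <ᵇ j) * H j i)) (∑∑-cong (λ i j → cong (𝟙 (i <ᵇ j) *_) (H-sym j i)))) ⟩
    ∑< H + ∑< H
      ≡⟨ cong (∑< H +_) (sym (+-identityʳ (∑< H))) ⟩
    2 * ∑< H ∎
    where open ≡-Reasoning

  -- Both sides are half the sum of H over ordered pairs of distinct points, which γ permutes.
  ∑<-reindex : (H : Fin n → Fin n → ℕ) → (∀ x y → H x y ≡ H y x) →
               {γ : Fin n → Fin n} → Injective _≡_ _≡_ γ → ∑< (λ i j → H (γ i) (γ j)) ≡ ∑< H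
  ∑<-reindex H H-sym {γ} γ-inj = *-cancelˡ-≡ _ _ 2 (begin
    2 * ∑< (λ i j → H (γ i) (γ j))                      ≡⟨ sym (∑≢≡2*∑< _ (λ x y → H-sym (γ x) (γ y))) ⟩
    ∑∑ (λ i j → 𝟙 (not (i == j)) * H (γ i) (γ j))       ≡⟨ ∑∑-cong (λ i j → cong (λ b → 𝟙 (not b) * H (γ i) (γ j)) (sym (==-injective γ-inj i j))) ⟩
    ∑∑ (λ i j → 𝟙 (not (γ i == γ j)) * H (γ i) (γ j))   ≡⟨ ∑∑-reindex γ-inj (λ x y → 𝟙 (not (x == y)) * H x y) ⟩
    ∑∑ (λ i j → 𝟙 (not (i == j)) * H i j)               ≡⟨ ∑≢≡2*∑< H H-sym ⟩
    2 * ∑< H                                             ∎)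
    where open ≡-Reasoning

  inversions : (Fin n → Fin n) → ℕ
  inversions σ = ∑< (λ i j → 𝟙 (σ j <ᵇ σ i))

  inversions-cong : {α β : Fin n → Fin n} → (∀ i → α i ≡ β i) → inversions α ≡ inversions β
  inversions-cong α≗β = ∑∑-cong (λ i j → cong (λ b → 𝟙 (i <ᵇ j) * 𝟙 b) (cong₂ _<ᵇ_ (α≗β j) (α≗β i)))

  reverses : (Fin n → Fin n) → Fin n → Fin n → ℕ
  reverses α x y = 𝟙 (x <ᵇ y) * 𝟙 (α y <ᵇ α x) + 𝟙 (y <ᵇ x) * 𝟙 (α x <ᵇ α y)

  reverses-sym : (α : Fin n → Fin n) → ∀ x y → reverses α x y ≡ reverses α y x
  reverses-sym α x y = +-comm (𝟙 (x <ᵇ y) * 𝟙 (α y <ᵇ α x)) _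

  inversions≡∑<reverses : (α : Fin n → Fin n) → inversions α ≡ ∑< (reverses α)
  inversions≡∑<reverses α = ∑<-cong at
    where
    at : ∀ {i j} → i Fin.< j → 𝟙 (α j <ᵇ α i) ≡ reverses α i j
    at i<j rewrite <ᵇ-true i<j | <ᵇ-false (<-asym i<j) = sym (trans (+-identityʳ _) (+-identityʳ _))

  -- With x = β i and y = β j for i < j, the three terms record whether α ∘ β, β and α invert
  -- the pair; α ∘ β inverts it exactly when one of β and α does.
  reversals-even : {α : Fin n → Fin n} → Injective _≡_ _≡_ α → ∀ {x y} → x ≢ y →
                   𝟙 (α y <ᵇ α x) + 𝟙 (y <ᵇ x) + reverses α x y ≡ 2 * (if x <ᵇ y then 𝟙 (α y <ᵇ α x) else 1)
  reversals-even {α = α} α-inj {x} {y} x≢y with <-cmp x y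
  ... | tri≈ _ x≡y _ = contradiction x≡y x≢y
  ... | tri< x<y _ y≮x rewrite <ᵇ-true x<y | <ᵇ-false y≮x with α y <ᵇ α x
  ...   | true  = refl
  ...   | false = refl
  reversals-even {α = α} α-inj {x} {y} x≢y | tri> x≮y _ y<x rewrite <ᵇ-false x≮y | <ᵇ-true y<x
    with α y <ᵇ α x | α x <ᵇ α y | trans (sym (≢-split (α y) (α x))) (cong (𝟙 ∘ not) (==-≢ (x≢y ∘ α-inj ∘ sym)))
  ...   | true  | false | _  = refl
  ...   | false | true  | _  = refl
  ...   | true  | true  | ()
  ...   | false | false | ()

  inversions-∘ : {α β : Fin n → Fin n} → Injective _≡_ _≡_ α → Injective _≡_ _≡_ β →
                 ∃ λ k → inversions (α ∘ β) + inversions β + inversions α ≡ 2 * k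
  inversions-∘ {α = α} {β} α-inj β-inj = ∑< half , (begin
    inversions (α ∘ β) + inversions β + inversions α
      ≡⟨ cong (inversions (α ∘ β) + inversions β +_) (trans (inversions≡∑<reverses α) (sym (∑<-reindex (reverses α) (reverses-sym α) β-inj))) ⟩
    ∑< inv-αβ + ∑< inv-β + ∑< rev-α
      ≡⟨ cong (_+ ∑< rev-α) (sym (∑<-distrib-+ inv-αβ inv-β)) ⟩
    ∑< (λ i j → inv-αβ i j + inv-β i j) + ∑< rev-α
      ≡⟨ sym (∑<-distrib-+ (λ i j → inv-αβ i j + inv-β i j) rev-α) ⟩
    ∑< (λ i j → inv-αβ i j + inv-β i j + rev-α i j)
      ≡⟨ ∑<-cong (λ i<j → reversals-even α-inj (<⇒≢ i<j ∘ β-inj)) ⟩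
    ∑< (λ i j → 2 * half i j)
      ≡⟨ ∑<-*ˡ 2 half ⟩
    2 * ∑< half ∎)
    where
    open ≡-Reasoning
    inv-αβ inv-β rev-α half : Fin _ → Fin _ → ℕ
    inv-αβ i j = 𝟙 (α (β j) <ᵇ α (β i))
    inv-β i j = 𝟙 (β j <ᵇ β i)
    rev-α i j = reverses α (β i) (β j)
    half i j = if β i <ᵇ β j then 𝟙 (α (β j) <ᵇ α (β i)) else 1

  swaps : (Fin n → Fin n) → ℕ
  swaps σ = ∑< (λ i j → 𝟙 (σ i == j))

  module Involution {σ : Fin n → Fin n} (σ-invol : ∀ i → σ (σ i) ≡ i) where

    σ-injective : Injective _≡_ _≡_ σ
    σ-injective {x} {y} σx≡σy = trans (sym (σ-invol x)) (trans (cong σ σx≡σy) (σ-invol y))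

    σ-==-sym : ∀ i j → (σ i == j) ≡ (σ j == i)
    σ-==-sym i j = trans (sym (==-injective σ-injective (σ i) j)) (trans (cong (_== σ j) (σ-invol i)) (==-comm i (σ j)))

    moved≡2*swaps : ∑[ i < n ] 𝟙 (not (σ i == i)) ≡ 2 * swaps σ
    moved≡2*swaps = trans (sum-cong-≗ (λ i → sym (row i))) (∑≢≡2*∑< (λ i j → 𝟙 (σ i == j)) (λ i j → cong 𝟙 (σ-==-sym i j)))
      where
      row : ∀ i → ∑[ j < n ] (𝟙 (not (i == j)) * 𝟙 (σ i == j)) ≡ 𝟙 (not (σ i == i))
      row i = trans (sum-single _ (σ i) vanish) at-σi
        where
        vanish : ∀ j → j ≢ σ i → 𝟙 (not (i == j)) * 𝟙 (σ i == j) ≡ 0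
        vanish j j≢σi rewrite ==-≢ (j≢σi ∘ sym) = *-zeroʳ (𝟙 (not (i == j)))
        at-σi : 𝟙 (not (i == σ i)) * 𝟙 (σ i == σ i) ≡ 𝟙 (not (σ i == i))
        at-σi rewrite ==-≡ {i = σ i} refl | ==-comm i (σ i) = *-identityʳ _

    -- (i , j) ↦ (σ j , σ i) maps inversions of σ to inversions; its fixed points are the
    -- two-cycles, and it exchanges the crossing-below and the crossing-above inversions.
    crossing-below crossing-above : Fin n → Fin n → ℕ
    crossing-below i j = 𝟙 (not (σ i == j)) * 𝟙 (σ j <ᵇ σ i) * 𝟙 (i <ᵇ σ j)
    crossing-above i j = 𝟙 (not (σ i == j)) * 𝟙 (σ j <ᵇ σ i) * 𝟙 (σ j <ᵇ i)

    inversion-split : ∀ {i j} → i Fin.< j → 𝟙 (σ j <ᵇ σ i) ≡ 𝟙 (σ i == j) + crossing-below i j + crossing-above i j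
    inversion-split {i} {j} i<j with σ i Fin.≟ j
    ... | yes σi≡j = cong 𝟙 (trans (cong₂ _<ᵇ_ σj≡i σi≡j) (<ᵇ-true i<j))
      where σj≡i = trans (cong σ (sym σi≡j)) (σ-invol i)
    ... | no  σi≢j
      with σ j <ᵇ σ i | i <ᵇ σ j | σ j <ᵇ i | trans (sym (≢-split i (σ j))) (cong (𝟙 ∘ not) (==-≢ (σi≢j ∘ σ-==-σ)))
      where σ-==-σ : i ≡ σ j → σ i ≡ j
            σ-==-σ i≡σj = trans (cong σ i≡σj) (σ-invol j)
    ... | false | _     | _     | _  = refl
    ... | true  | true  | false | _  = refl
    ... | true  | false | true  | _  = refl
    ... | true  | true  | true  | ()
    ... | true  | false | false | ()

    ∑<crossing-above≡∑<crossing-below : ∑< crossing-above ≡ ∑< crossing-below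
    ∑<crossing-above≡∑<crossing-below = sym (begin
      ∑∑ (λ i j → 𝟙 (i <ᵇ j) * crossing-below i j)      ≡⟨ ∑∑-cong mirror ⟩
      ∑∑ (λ i j → F (σ j) (σ i))                         ≡⟨ ∑∑-transpose (λ i j → F (σ i) (σ j)) ⟩
      ∑∑ (λ i j → F (σ i) (σ j))                         ≡⟨ ∑∑-reindex σ-injective F ⟩
      ∑∑ F                                               ∎)
      where
      open ≡-Reasoning
      F : Fin n → Fin n → ℕ
      F i j = 𝟙 (i <ᵇ j) * crossing-above i j
      mirror : ∀ i j → 𝟙 (i <ᵇ j) * crossing-below i j ≡ F (σ j) (σ i)
      mirror i j rewrite σ-invol i | σ-invol j | ==-comm j (σ i) =
        solve 4 (λ a b c d → a :* (b :* c :* d) := c :* (b :* a :* d)) refl (𝟙 (i <ᵇ j)) (𝟙 (not (σ i == j))) (𝟙 (σ j <ᵇ σ i)) (𝟙 (i <ᵇ σ j))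

    inversions-involution : ∃ λ k → inversions σ ≡ swaps σ + 2 * k
    inversions-involution = ∑< crossing-below , (begin
      inversions σ
        ≡⟨ ∑<-cong inversion-split ⟩
      ∑< (λ i j → 𝟙 (σ i == j) + crossing-below i j + crossing-above i j)
        ≡⟨ ∑<-distrib-+ (λ i j → 𝟙 (σ i == j) + crossing-below i j) crossing-above ⟩
      ∑< (λ i j → 𝟙 (σ i == j) + crossing-below i j) + ∑< crossing-above
        ≡⟨ cong₂ _+_ (∑<-distrib-+ (λ i j → 𝟙 (σ i == j)) crossing-below) ∑<crossing-above≡∑<crossing-below ⟩
      swaps σ + ∑< crossing-below + ∑< crossing-below
        ≡⟨ +-assoc (swaps σ) _ _ ⟩
      swaps σ + (∑< crossing-below + ∑< crossing-below)
        ≡⟨ cong (λ x → swaps σ + (∑< crossing-below + x)) (sym (+-identityʳ _)) ⟩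
      swaps σ + 2 * ∑< crossing-below ∎)
      where open ≡-Reasoning

  count-tabulate : (f : Fin n → Bool) {m : ℕ} (g : Fin m → Fin n) →
                   length (filter (λ i → f i Bool.≟ true) (List.tabulate g)) ≡ ∑[ k < m ] 𝟙 (f (g k))
  count-tabulate f {zero}  g = refl
  count-tabulate f {suc m} g with f (g zero)
  ... | true  = cong suc (count-tabulate f (g ∘ suc))
  ... | false = count-tabulate f (g ∘ suc)

  countB≡∑𝟙 : (f : Fin n → Bool) → countB f ≡ ∑[ i < n ] 𝟙 (f i)
  countB≡∑𝟙 f = count-tabulate f (λ i → i)
  2*n/2≡n : ∀ k → (2 * k) / 2 ≡ k
  2*n/2≡n k = trans (cong (_/ 2) (*-comm 2 k)) (m*n/n≡m k 2)

  twoCycles≡moved/2 : (σ : Word n) → twoCycles σ ≡ (∑[ i < n ] 𝟙 (not (lookup σ i == i))) / 2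
  twoCycles≡moved/2 σ = cong (_/ 2) (countB≡∑𝟙 (λ i → not (lookup σ i == i)))

  twoCycles≡swaps : {σ : Word n} → isInvolution σ ≡ true → twoCycles σ ≡ swaps (lookup σ)
  twoCycles≡swaps {σ = σ} σ-invol = trans (twoCycles≡moved/2 σ)
    (trans (cong (_/ 2) (Involution.moved≡2*swaps {σ = lookup σ} (isInvolution⇒involutive {σ = σ} σ-invol))) (2*n/2≡n _))

  countB≤n : ∀ {n} (f : Fin n → Bool) → countB f ℕ.≤ n
  countB≤n {n} f = ℕ.≤-trans (List.length-filter (λ i → f i Bool.≟ true) (List.allFin n)) (ℕ.≤-reflexive (List.length-tabulate {n = n} (λ i → i)))

  twoCycles≤n/2 : ∀ {n} (σ : Word n) → twoCycles σ ℕ.≤ n / 2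
  twoCycles≤n/2 σ = /-monoˡ-≤ 2 (countB≤n (λ i → not (lookup σ i == i)))
  pairing : ℕ → Fin n → Fin n
  pairing zero i = i
  pairing {suc (suc n)} (suc s) zero          = suc zero
  pairing {suc (suc n)} (suc s) (suc zero)    = zero
  pairing {suc (suc n)} (suc s) (suc (suc i)) = suc (suc (pairing s i))
  pairing {suc zero}    (suc s) i             = i

  pairing-involutive : ∀ s (i : Fin n) → pairing s (pairing s i) ≡ i
  pairing-involutive zero i = refl
  pairing-involutive {suc (suc n)} (suc s) zero          = refl
  pairing-involutive {suc (suc n)} (suc s) (suc zero)    = refl
  pairing-involutive {suc (suc n)} (suc s) (suc (suc i)) = cong (λ j → suc (suc j)) (pairing-involutive s i)
  pairing-involutive {suc zero}    (suc s) i             = refl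

  pairing-moved : ∀ s → 2 * s ≤ n → ∑[ i < n ] 𝟙 (not (pairing s i == i)) ≡ 2 * s
  pairing-moved {n} zero _ = trans fixed (sum-replicate-zero n)
    where
    fixed : ∑[ i < n ] 𝟙 (not (i == i)) ≡ ∑[ i < n ] 0
    fixed = sum-cong-≗ {n} {λ i → 𝟙 (not (i == i))} (λ i → cong (𝟙 ∘ not) (==-≡ {i = i} refl))
  pairing-moved {suc (suc n)} (suc s) 2s+2≤n+2 = begin
    2 + ∑[ i < n ] 𝟙 (not (suc (suc (pairing s i)) == suc (suc i)))  ≡⟨ cong (2 +_) shifted ⟩
    2 + ∑[ i < n ] 𝟙 (not (pairing s i == i))                        ≡⟨ cong (2 +_) (pairing-moved s 2s≤n) ⟩
    2 + 2 * s                                                        ≡⟨ sym (*-suc 2 s) ⟩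
    2 * suc s                                                        ∎
    where
    open ≡-Reasoning
    shifted : ∑[ i < n ] 𝟙 (not (suc (suc (pairing s i)) == suc (suc i))) ≡ ∑[ i < n ] 𝟙 (not (pairing s i == i))
    shifted = sum-cong-≗ {n} {λ i → 𝟙 (not (suc (suc (pairing s i)) == suc (suc i)))} (λ i → cong (𝟙 ∘ not) (==-injective (Fin.suc-injective ∘ Fin.suc-injective) (pairing s i) i))
    2s≤n : 2 * s ≤ n
    2s≤n = ≤-pred (≤-pred (subst (_≤ suc (suc n)) (*-suc 2 s) 2s+2≤n+2))
  pairing-moved {suc zero} (suc s) (s≤s s+[1+s]≤0) with subst (_≤ 0) (+-suc s _) s+[1+s]≤0
  ... | ()
  pairing-moved {zero} (suc s) ()

  pairingPerm : ℕ → Word n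
  pairingPerm s = tabulate (pairing s)

  pairingPerm-involution : ∀ s → isInvolution (pairingPerm {n} s) ≡ true
  pairingPerm-involution {n} s = allB⁺ {f = λ i → lookup σ (lookup σ i) == i} (λ i → ==-≡ (begin
    lookup (pairingPerm s) (lookup (pairingPerm s) i)  ≡⟨ cong (lookup (pairingPerm s)) (lookup∘tabulate (pairing s) i) ⟩
    lookup (pairingPerm s) (pairing s i)               ≡⟨ lookup∘tabulate (pairing s) (pairing s i) ⟩
    pairing s (pairing s i)                            ≡⟨ pairing-involutive s i ⟩
    i                                                  ∎))
    where
    open ≡-Reasoning
    σ = pairingPerm {n} s

  pairingPerm-perm : ∀ s → isPerm (pairingPerm {n} s) ≡ true
  pairingPerm-perm {n} s = injective⇒isPerm {σ = σ} (Involution.σ-injective {σ = lookup σ} (isInvolution⇒involutive {σ = σ} (pairingPerm-involution {n} s)))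
    where σ = pairingPerm {n} s

  pairingPerm-twoCycles : ∀ s → 2 * s ≤ n → twoCycles (pairingPerm {n} s) ≡ s
  pairingPerm-twoCycles {n} s 2s≤n = begin
    twoCycles σ                                   ≡⟨ twoCycles≡moved/2 σ ⟩
    (∑[ i < n ] 𝟙 (not (lookup σ i == i))) / 2    ≡⟨ cong (_/ 2) (sum-cong-≗ {n} {λ i → 𝟙 (not (lookup σ i == i))} (λ i → cong (λ j → 𝟙 (not (j == i))) (lookup∘tabulate (pairing s) i))) ⟩
    (∑[ i < n ] 𝟙 (not (pairing s i == i))) / 2   ≡⟨ cong (_/ 2) (pairing-moved s 2s≤n) ⟩
    (2 * s) / 2                                   ≡⟨ 2*n/2≡n s ⟩
    s                                             ∎
    where
    open ≡-Reasoning
    σ = pairingPerm {n} s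

  classSize-nonZero : ∀ s → 2 * s ≤ n → ∃ λ c → classSize n s ≡ suc c
  classSize-nonZero {n} s 2s≤n = nonEmpty (∈-filter⁺ (λ τ → (isInvolution τ ∧ ⌊ twoCycles τ ≟ s ⌋) Bool.≟ true)
    (isPerm⇒∈-Sym {σ = pairingPerm {n} s} (pairingPerm-perm {n} s)) inClass)
    where
    nonEmpty : {A : Set} {x : A} {xs : List A} → x ∈ xs → ∃ λ c → length xs ≡ suc c
    nonEmpty {xs = _ ∷ xs} _ = length xs , refl
    inClass : (isInvolution (pairingPerm {n} s) ∧ ⌊ twoCycles (pairingPerm {n} s) ≟ s ⌋) ≡ true
    inClass rewrite pairingPerm-involution {n} s | pairingPerm-twoCycles {n} s 2s≤n = ⌊⌋-true (s ≟ s) refl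

open Counting

import Data.Integer as ℤ
import Data.Integer.Properties as ℤ
import Data.Nat.Coprimality as Coprime
open import Data.Rational using (ℚ; 0ℚ; 1ℚ; ½; mkℚ; _+_; _*_; -_; _-_; _≤_; _<_; _/_; ∣_∣; _⊔_; nonNegative)
open import Data.Rational.Properties
open import Data.Rational.Solver using (module +-*-Solver)
open +-*-Solver
open FinSum +-0-commutativeMonoid

ℕtoℚ≡mkℚ : ∀ k → ℕtoℚ k ≡ mkℚ (ℤ.+ k) 0 (Coprime.sym (Coprime.1-coprimeTo k))
ℕtoℚ≡mkℚ k = normalize-coprime (Coprime.sym (Coprime.1-coprimeTo k))

ℕtoℚ-suc : ∀ k → ℕtoℚ (suc k) ≡ 1ℚ + ℕtoℚ k
ℕtoℚ-suc k rewrite ℕtoℚ≡mkℚ k | ℤ.*-identityʳ (ℤ.+ k) = refl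

ℕtoℚ-+ : ∀ a b → ℕtoℚ (a ℕ.+ b) ≡ ℕtoℚ a + ℕtoℚ b
ℕtoℚ-+ zero    b = sym (+-identityˡ (ℕtoℚ b))
ℕtoℚ-+ (suc a) b = begin
  ℕtoℚ (suc (a ℕ.+ b))        ≡⟨ ℕtoℚ-suc (a ℕ.+ b) ⟩
  1ℚ + ℕtoℚ (a ℕ.+ b)         ≡⟨ cong (λ x → 1ℚ + x) (ℕtoℚ-+ a b) ⟩
  1ℚ + (ℕtoℚ a + ℕtoℚ b)      ≡⟨ sym (+-assoc 1ℚ (ℕtoℚ a) (ℕtoℚ b)) ⟩
  1ℚ + ℕtoℚ a + ℕtoℚ b        ≡⟨ cong (_+ ℕtoℚ b) (sym (ℕtoℚ-suc a)) ⟩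
  ℕtoℚ (suc a) + ℕtoℚ b       ∎
  where open ≡-Reasoning

ℕtoℚ-* : ∀ a b → ℕtoℚ (a ℕ.* b) ≡ ℕtoℚ a * ℕtoℚ b
ℕtoℚ-* zero    b = sym (*-zeroˡ (ℕtoℚ b))
ℕtoℚ-* (suc a) b = begin
  ℕtoℚ (b ℕ.+ a ℕ.* b)         ≡⟨ ℕtoℚ-+ b (a ℕ.* b) ⟩
  ℕtoℚ b + ℕtoℚ (a ℕ.* b)      ≡⟨ cong (λ x → ℕtoℚ b + x) (ℕtoℚ-* a b) ⟩
  ℕtoℚ b + ℕtoℚ a * ℕtoℚ b     ≡⟨ solve 2 (λ x y → y :+ x :* y := (con 1ℚ :+ x) :* y) refl (ℕtoℚ a) (ℕtoℚ b) ⟩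
  (1ℚ + ℕtoℚ a) * ℕtoℚ b       ≡⟨ cong (_* ℕtoℚ b) (sym (ℕtoℚ-suc a)) ⟩
  ℕtoℚ (suc a) * ℕtoℚ b        ∎
  where open ≡-Reasoning

recipℕ-inverse : ∀ k → recipℕ (suc k) * ℕtoℚ (suc k) ≡ 1ℚ
recipℕ-inverse k rewrite ℕtoℚ≡mkℚ (suc k) | normalize-coprime {1} {k} (Coprime.1-coprimeTo (suc k)) =
  *-inverseˡ (mkℚ (ℤ.+ suc k) 0 (Coprime.sym (Coprime.1-coprimeTo (suc k))))

ℕtoℚ-nonNeg : ∀ k → 0ℚ ≤ ℕtoℚ k
ℕtoℚ-nonNeg k = nonNegative⁻¹ (ℕtoℚ k) {{normalize-nonNeg k 1}}

recipℕ-nonNeg : ∀ k → 0ℚ ≤ recipℕ k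
recipℕ-nonNeg zero    = ≤-refl
recipℕ-nonNeg (suc k) = nonNegative⁻¹ (recipℕ (suc k)) {{normalize-nonNeg 1 (suc k)}}

ℕtoℚ-mono-≤ : ∀ {a b} → a ℕ.≤ b → ℕtoℚ a ≤ ℕtoℚ b
ℕtoℚ-mono-≤ {a} {b} a≤b = begin
  ℕtoℚ a                      ≡⟨ sym (+-identityʳ (ℕtoℚ a)) ⟩
  ℕtoℚ a + 0ℚ                 ≤⟨ +-monoʳ-≤ (ℕtoℚ a) (ℕtoℚ-nonNeg (b ℕ.∸ a)) ⟩
  ℕtoℚ a + ℕtoℚ (b ℕ.∸ a)     ≡⟨ sym (ℕtoℚ-+ a (b ℕ.∸ a)) ⟩
  ℕtoℚ (a ℕ.+ (b ℕ.∸ a))      ≡⟨ cong ℕtoℚ (ℕ.m+[n∸m]≡n a≤b) ⟩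
  ℕtoℚ b                      ∎
  where open ≤-Reasoning

*-nonNeg : ∀ {x y} → 0ℚ ≤ x → 0ℚ ≤ y → 0ℚ ≤ x * y
*-nonNeg {x} {y} 0≤x 0≤y = subst (_≤ x * y) (*-zeroʳ x) (*-monoˡ-≤-nonNeg x {{nonNegative 0≤x}} 0≤y)

≤-recipℕ : ∀ {x} k → x * ℕtoℚ (suc k) ≤ 1ℚ → x ≤ recipℕ (suc k)
≤-recipℕ {x} k xN≤1 = begin
  x                               ≡⟨ solve 1 (λ x → x := x :* con 1ℚ) refl x ⟩
  x * 1ℚ                          ≡⟨ cong (x *_) (sym (recipℕ-inverse k)) ⟩
  x * (r * N)                     ≡⟨ solve 3 (λ x r n → x :* (r :* n) := (x :* n) :* r) refl x r N ⟩
  (x * N) * r                     ≤⟨ *-monoʳ-≤-nonNeg r {{nonNegative (recipℕ-nonNeg (suc k))}} xN≤1 ⟩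
  1ℚ * r                          ≡⟨ *-identityˡ r ⟩
  r                               ∎
  where
  open ≤-Reasoning
  r = recipℕ (suc k)
  N = ℕtoℚ (suc k)

p≤∣p∣ : ∀ p → p ≤ ∣ p ∣
p≤∣p∣ p with ∣p∣≡p∨∣p∣≡-p p
... | inj₁ ∣p∣≡p  = ≤-reflexive (sym ∣p∣≡p)
... | inj₂ ∣p∣≡-p = ≤-trans (subst₂ _≤_ (solve 1 (λ x → :- (:- x) := x) refl p) refl (neg-antimono-≤ (subst (0ℚ ≤_) ∣p∣≡-p (0≤∣p∣ p)))) (0≤∣p∣ p)

x≡-x⇒x≡0 : ∀ {x} → x ≡ - x → x ≡ 0ℚ
x≡-x⇒x≡0 {x} x≡-x = begin
  x              ≡⟨ solve 1 (λ x → x := con ½ :* (x :+ x)) refl x ⟩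
  ½ * (x + x)    ≡⟨ cong (λ y → ½ * (x + y)) x≡-x ⟩
  ½ * (x + - x)  ≡⟨ solve 1 (λ x → con ½ :* (x :+ :- x) := con 0ℚ) refl x ⟩
  0ℚ             ∎
  where open ≡-Reasoning

sgn : ℕ → ℚ
sgn zero    = 1ℚ
sgn (suc k) = - sgn k

sgn-+ : ∀ a b → sgn (a ℕ.+ b) ≡ sgn a * sgn b
sgn-+ zero    b = sym (*-identityˡ (sgn b))
sgn-+ (suc a) b = trans (cong -_ (sgn-+ a b)) (neg-distribˡ-* (sgn a) (sgn b))

sgn² : ∀ k → sgn k * sgn k ≡ 1ℚ
sgn² zero    = refl
sgn² (suc k) = trans (solve 1 (λ x → (:- x) :* (:- x) := x :* x) refl (sgn k)) (sgn² k)

sgn-2* : ∀ k → sgn (2 ℕ.* k) ≡ 1ℚ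
sgn-2* k = trans (sgn-+ k (k ℕ.+ 0)) (trans (cong (λ x → sgn k * sgn x) (ℕ.+-identityʳ k)) (sgn² k))

sgn-+2* : ∀ a k → sgn (a ℕ.+ 2 ℕ.* k) ≡ sgn a
sgn-+2* a k = trans (sgn-+ a (2 ℕ.* k)) (trans (cong (sgn a *_) (sgn-2* k)) (*-identityʳ (sgn a)))

sgn-parity : ∀ a b k → a ℕ.+ b ≡ 2 ℕ.* k → sgn a ≡ sgn b
sgn-parity a b k a+b≡2k = begin
  sgn a                          ≡⟨ solve 1 (λ x → x := x :* con 1ℚ) refl (sgn a) ⟩
  sgn a * 1ℚ                     ≡⟨ cong (sgn a *_) (sym (sgn² b)) ⟩
  sgn a * (sgn b * sgn b)        ≡⟨ sym (*-assoc (sgn a) (sgn b) (sgn b)) ⟩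
  sgn a * sgn b * sgn b          ≡⟨ cong (_* sgn b) (sym (sgn-+ a b)) ⟩
  sgn (a ℕ.+ b) * sgn b          ≡⟨ cong (λ x → sgn x * sgn b) a+b≡2k ⟩
  sgn (2 ℕ.* k) * sgn b          ≡⟨ cong (_* sgn b) (sgn-2* k) ⟩
  1ℚ * sgn b                     ≡⟨ *-identityˡ (sgn b) ⟩
  sgn b                          ∎
  where open ≡-Reasoning

sgn-even : ∀ {k} → 2 ∣ k → sgn k ≡ 1ℚ
sgn-even (divides q refl) = trans (cong sgn (ℕ.*-comm q 2)) (sgn-2* q)

isEven : ℕ → Bool
isEven zero    = true
isEven (suc k) = not (isEven k)

sgn≡±1 : ∀ k → sgn k ≡ (if isEven k then 1ℚ else - 1ℚ)
sgn≡±1 zero    = refl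
sgn≡±1 (suc k) rewrite sgn≡±1 k with isEven k
... | true  = refl
... | false = refl

^ℚ-+ : ∀ a i j → a ^ℚ (i ℕ.+ j) ≡ a ^ℚ i * a ^ℚ j
^ℚ-+ a zero    j = sym (*-identityˡ _)
^ℚ-+ a (suc i) j = trans (cong (a *_) (^ℚ-+ a i j)) (sym (*-assoc a (a ^ℚ i) (a ^ℚ j)))

^ℚ-* : ∀ a m k → (a ^ℚ m) ^ℚ k ≡ a ^ℚ (m ℕ.* k)
^ℚ-* a m zero    = cong (a ^ℚ_) (sym (ℕ.*-zeroʳ m))
^ℚ-* a m (suc k) = begin
  a ^ℚ m * (a ^ℚ m) ^ℚ k    ≡⟨ cong (a ^ℚ m *_) (^ℚ-* a m k) ⟩
  a ^ℚ m * a ^ℚ (m ℕ.* k)   ≡⟨ sym (^ℚ-+ a m (m ℕ.* k)) ⟩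
  a ^ℚ (m ℕ.+ m ℕ.* k)      ≡⟨ cong (a ^ℚ_) (sym (ℕ.*-suc m k)) ⟩
  a ^ℚ (m ℕ.* suc k)        ∎
  where open ≡-Reasoning

^ℚ-neg : ∀ a k → (- a) ^ℚ k ≡ sgn k * a ^ℚ k
^ℚ-neg a zero    = sym (*-identityˡ 1ℚ)
^ℚ-neg a (suc k) = trans (cong (- a *_) (^ℚ-neg a k)) (solve 3 (λ a s b → (:- a) :* (s :* b) := (:- s) :* (a :* b)) refl a (sgn k) (a ^ℚ k))

^ℚ-neg-even : ∀ a {k} → 2 ∣ k → (- a) ^ℚ k ≡ a ^ℚ k
^ℚ-neg-even a {k} 2∣k = trans (^ℚ-neg a k) (trans (cong (_* a ^ℚ k) (sgn-even 2∣k)) (*-identityˡ (a ^ℚ k)))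

bernoulli : ∀ {a} → 0ℚ ≤ a → a ≤ 1ℚ → ∀ k → 1ℚ - ℕtoℚ k * a ≤ (1ℚ - a) ^ℚ k
bernoulli {a} _   _   zero    = ≤-reflexive (solve 1 (λ a → con 1ℚ :- con 0ℚ :* a := con 1ℚ) refl a)
bernoulli {a} 0≤a a≤1 (suc k) = begin
  1ℚ - ℕtoℚ (suc k) * a                              ≡⟨ cong (λ z → 1ℚ - z * a) (ℕtoℚ-suc k) ⟩
  1ℚ - (1ℚ + ℕtoℚ k) * a                             ≡⟨ sym (+-identityʳ _) ⟩
  1ℚ - (1ℚ + ℕtoℚ k) * a + 0ℚ                        ≤⟨ +-monoʳ-≤ (1ℚ - (1ℚ + ℕtoℚ k) * a) (*-nonNeg (ℕtoℚ-nonNeg k) (*-nonNeg 0≤a 0≤a)) ⟩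
  1ℚ - (1ℚ + ℕtoℚ k) * a + ℕtoℚ k * (a * a)          ≡⟨ solve 2 (λ a c → con 1ℚ :- (con 1ℚ :+ c) :* a :+ c :* (a :* a) := (con 1ℚ :- a) :* (con 1ℚ :- c :* a)) refl a (ℕtoℚ k) ⟩
  (1ℚ - a) * (1ℚ - ℕtoℚ k * a)                       ≤⟨ *-monoˡ-≤-nonNeg (1ℚ - a) {{nonNegative 0≤1-a}} (bernoulli 0≤a a≤1 k) ⟩
  (1ℚ - a) * (1ℚ - a) ^ℚ k                           ∎
  where
  open ≤-Reasoning
  0≤1-a : 0ℚ ≤ 1ℚ - a
  0≤1-a = subst (_≤ 1ℚ - a) (+-inverseʳ a) (+-monoˡ-≤ (- a) a≤1)

module Binomial where
  private
    ℚ-semiring : CommutativeSemiring _ _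
    ℚ-semiring = CommutativeRing.commutativeSemiring +-*-commutativeRing
  open import Algebra.Properties.CommutativeSemiring.Binomial ℚ-semiring using (theorem)
  open import Algebra.Properties.Semiring.Exp (CommutativeSemiring.semiring ℚ-semiring) using (_^_)
  open import Algebra.Definitions.RawMonoid (CommutativeSemiring.+-rawMonoid ℚ-semiring) using () renaming (_×_ to _·_)

  ^ℚ≡^ : ∀ x k → x ^ℚ k ≡ x ^ k
  ^ℚ≡^ x zero    = refl
  ^ℚ≡^ x (suc k) = cong (x *_) (^ℚ≡^ x k)

  ·≡ℕtoℚ* : ∀ k x → k · x ≡ ℕtoℚ k * x
  ·≡ℕtoℚ* zero    x = sym (*-zeroˡ x)
  ·≡ℕtoℚ* (suc k) x = begin
    x + k · x             ≡⟨ cong (x +_) (·≡ℕtoℚ* k x) ⟩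
    x + ℕtoℚ k * x        ≡⟨ solve 2 (λ x c → x :+ c :* x := (con 1ℚ :+ c) :* x) refl x (ℕtoℚ k) ⟩
    (1ℚ + ℕtoℚ k) * x     ≡⟨ cong (_* x) (sym (ℕtoℚ-suc k)) ⟩
    ℕtoℚ (suc k) * x      ∎
    where open ≡-Reasoning

  binomial : ∀ m x y → (x + y) ^ℚ m ≡ ∑[ j < suc m ] (ℕtoℚ (m C toℕ j) * (x ^ℚ toℕ j * y ^ℚ (m ∸ toℕ j)))
  binomial m x y = trans (^ℚ≡^ (x + y) m) (trans (theorem m x y) (sum-cong-≗ {suc m} term))
    where
    term : ∀ j → (m C toℕ j) · (x ^ toℕ j * y ^ (m ∸ toℕ j)) ≡ ℕtoℚ (m C toℕ j) * (x ^ℚ toℕ j * y ^ℚ (m ∸ toℕ j))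
    term j = trans (·≡ℕtoℚ* (m C toℕ j) _) (cong (ℕtoℚ (m C toℕ j) *_) (sym (cong₂ _*_ (^ℚ≡^ x (toℕ j)) (^ℚ≡^ y (m ∸ toℕ j)))))

open Binomial using (binomial)

χ : Word n → ℚ
χ σ = sgn (inversions (lookup σ))

χ-∘ₚ : {α β : Word n} → isPerm α ≡ true → isPerm β ≡ true → χ (α ∘ₚ β) ≡ χ α * χ β
χ-∘ₚ {α = α} {β} α-perm β-perm with inversions-∘ (isPerm⇒injective {σ = α} α-perm) (isPerm⇒injective {σ = β} β-perm)
... | k , I-αβ+I-β+I-α≡2k = begin
  χ (α ∘ₚ β)               ≡⟨ cong sgn (inversions-cong (lookup-∘ₚ α β)) ⟩
  sgn I-αβ                 ≡⟨ sgn-parity I-αβ (I-β ℕ.+ I-α) k (trans (sym (ℕ.+-assoc I-αβ I-β I-α)) I-αβ+I-β+I-α≡2k) ⟩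
  sgn (I-β ℕ.+ I-α)        ≡⟨ sgn-+ I-β I-α ⟩
  χ β * χ α                ≡⟨ *-comm (χ β) (χ α) ⟩
  χ α * χ β                ∎
  where
  open ≡-Reasoning
  I-αβ = inversions (λ i → lookup α (lookup β i))
  I-β = inversions (lookup β)
  I-α = inversions (lookup α)

χ-involution : {σ : Word n} → isInvolution σ ≡ true → χ σ ≡ sgn (twoCycles σ)
χ-involution {σ = σ} σ-invol with Involution.inversions-involution {σ = lookup σ} (isInvolution⇒involutive {σ = σ} σ-invol)
... | k , I≡swaps+2k = begin
  sgn (inversions (lookup σ))          ≡⟨ cong sgn I≡swaps+2k ⟩
  sgn (swaps (lookup σ) ℕ.+ 2 ℕ.* k)   ≡⟨ sgn-+2* (swaps (lookup σ)) k ⟩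
  sgn (swaps (lookup σ))               ≡⟨ cong sgn (sym (twoCycles≡swaps {σ = σ} σ-invol)) ⟩
  sgn (twoCycles σ)                    ∎
  where open ≡-Reasoning

χ-pairingPerm : ∀ s → 2 ℕ.* s ℕ.≤ n → χ (pairingPerm {n} s) ≡ sgn s
χ-pairingPerm {n} s 2s≤n = trans (χ-involution {σ = pairingPerm {n} s} (pairingPerm-involution {n} s)) (cong sgn (pairingPerm-twoCycles s 2s≤n))

χ-id : χ (idPerm {n}) ≡ 1ℚ
χ-id {n} = χ-pairingPerm {n} 0 z≤n

private variable A B : Set

∑ₗ : List A → (A → ℚ) → ℚ
∑ₗ xs f = sumℚ (List.map f xs)

syntax ∑ₗ xs (λ x → e) = ∑[ x ∈ xs ] e

module _ {f g : A → ℚ} where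

  ∑ₗ-cong-∈ : ∀ xs → (∀ {x} → x ∈ xs → f x ≡ g x) → ∑ₗ xs f ≡ ∑ₗ xs g
  ∑ₗ-cong-∈ []       _   = refl
  ∑ₗ-cong-∈ (x ∷ xs) f≗g = cong₂ _+_ (f≗g (here refl)) (∑ₗ-cong-∈ xs (f≗g ∘ there))

  ∑ₗ-cong : ∀ xs → (∀ x → f x ≡ g x) → ∑ₗ xs f ≡ ∑ₗ xs g
  ∑ₗ-cong xs f≗g = ∑ₗ-cong-∈ xs (λ {x} _ → f≗g x)

  ∑ₗ-distrib-+ : ∀ xs → ∑[ x ∈ xs ] (f x + g x) ≡ ∑ₗ xs f + ∑ₗ xs g
  ∑ₗ-distrib-+ []       = refl
  ∑ₗ-distrib-+ (x ∷ xs) = trans (cong (f x + g x +_) (∑ₗ-distrib-+ xs))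
    (solve 4 (λ a b c d → (a :+ b) :+ (c :+ d) := (a :+ c) :+ (b :+ d)) refl (f x) (g x) (∑ₗ xs f) (∑ₗ xs g))

∑ₗ-*ˡ : (c : ℚ) (f : A → ℚ) → ∀ xs → ∑[ x ∈ xs ] (c * f x) ≡ c * ∑ₗ xs f
∑ₗ-*ˡ c f []       = sym (*-zeroʳ c)
∑ₗ-*ˡ c f (x ∷ xs) = trans (cong (c * f x +_) (∑ₗ-*ˡ c f xs)) (sym (*-distribˡ-+ c (f x) (∑ₗ xs f)))

∑ₗ-*ʳ : (c : ℚ) (f : A → ℚ) → ∀ xs → ∑[ x ∈ xs ] (f x * c) ≡ ∑ₗ xs f * c
∑ₗ-*ʳ c f xs = trans (∑ₗ-cong xs (λ x → *-comm (f x) c)) (trans (∑ₗ-*ˡ c f xs) (*-comm c (∑ₗ xs f)))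

∑ₗ-zero : ∀ (xs : List A) → ∑[ x ∈ xs ] 0ℚ ≡ 0ℚ
∑ₗ-zero []       = refl
∑ₗ-zero (x ∷ xs) = trans (+-identityˡ _) (∑ₗ-zero xs)

∑ₗ-++ : (f : A → ℚ) → ∀ xs ys → ∑ₗ (xs ++ ys) f ≡ ∑ₗ xs f + ∑ₗ ys f
∑ₗ-++ f []       ys = sym (+-identityˡ _)
∑ₗ-++ f (x ∷ xs) ys = trans (cong (f x +_) (∑ₗ-++ f xs ys)) (sym (+-assoc (f x) (∑ₗ xs f) (∑ₗ ys f)))

∑ₗ-map : (f : B → ℚ) (g : A → B) → ∀ xs → ∑ₗ (List.map g xs) f ≡ ∑ₗ xs (f ∘ g)
∑ₗ-map f g []       = refl
∑ₗ-map f g (x ∷ xs) = cong (f (g x) +_) (∑ₗ-map f g xs)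

∑ₗ-concatMap : (f : B → ℚ) (F : A → List B) → ∀ xs → ∑ₗ (concatMap F xs) f ≡ ∑[ x ∈ xs ] ∑ₗ (F x) f
∑ₗ-concatMap f F []       = refl
∑ₗ-concatMap f F (x ∷ xs) = trans (∑ₗ-++ f (F x) (concatMap F xs)) (cong (∑ₗ (F x) f +_) (∑ₗ-concatMap f F xs))

sumℚ-concatMap : (F : A → List ℚ) → ∀ xs → sumℚ (concatMap F xs) ≡ ∑[ x ∈ xs ] sumℚ (F x)
sumℚ-concatMap F xs = begin
  sumℚ (concatMap F xs)                    ≡⟨ cong sumℚ (sym (List.map-id (concatMap F xs))) ⟩
  ∑ₗ (concatMap F xs) (λ q → q)            ≡⟨ ∑ₗ-concatMap (λ q → q) F xs ⟩
  ∑[ x ∈ xs ] ∑ₗ (F x) (λ q → q)           ≡⟨ ∑ₗ-cong xs (λ x → cong sumℚ (List.map-id (F x))) ⟩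
  ∑[ x ∈ xs ] sumℚ (F x)                   ∎
  where open ≡-Reasoning

∑ₗ-comm : (f : A → B → ℚ) → ∀ xs ys → ∑[ x ∈ xs ] ∑[ y ∈ ys ] f x y ≡ ∑[ y ∈ ys ] ∑[ x ∈ xs ] f x y
∑ₗ-comm f []       ys = sym (∑ₗ-zero ys)
∑ₗ-comm f (x ∷ xs) ys = trans (cong (∑ₗ ys (f x) +_) (∑ₗ-comm f xs ys)) (sym (∑ₗ-distrib-+ ys))

∑ₗ-filter : (p : A → Bool) (f : A → ℚ) → ∀ xs →
            ∑ₗ (filter (λ x → p x Bool.≟ true) xs) f ≡ ∑[ x ∈ xs ] (if p x then f x else 0ℚ)
∑ₗ-filter p f []       = refl
∑ₗ-filter p f (x ∷ xs) with p x
... | true  = cong (f x +_) (∑ₗ-filter p f xs)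
... | false = trans (∑ₗ-filter p f xs) (sym (+-identityˡ _))

∑ₗ-tabulate : (f : A → ℚ) (g : Fin n → A) → ∑ₗ (List.tabulate g) f ≡ ∑[ i < n ] f (g i)
∑ₗ-tabulate {n = zero}  f g = refl
∑ₗ-tabulate {n = suc n} f g = cong (f (g zero) +_) (∑ₗ-tabulate f (g ∘ suc))

∑ₗ-allFin : (f : Fin n → ℚ) → ∑ₗ (allFin n) f ≡ ∑[ i < n ] f i
∑ₗ-allFin f = ∑ₗ-tabulate f (λ i → i)

∑ₗ-allVecs-single : ∀ k (f : Vec (Fin n) k → ℚ) (x : Vec (Fin n) k) → (∀ w → w ≢ x → f w ≡ 0ℚ) → ∑ₗ (allVecs n k) f ≡ f x
∑ₗ-allVecs-single zero    f [] _ = +-identityʳ (f [])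
∑ₗ-allVecs-single {n} (suc k) f (a ∷ x) f-vanishes = begin
  ∑ₗ (allVecs n (suc k)) f                                 ≡⟨ ∑ₗ-concatMap f (λ i → List.map (i ∷_) (allVecs n k)) (allFin n) ⟩
  ∑[ i ∈ allFin n ] ∑ₗ (List.map (i ∷_) (allVecs n k)) f   ≡⟨ ∑ₗ-cong (allFin n) (λ i → ∑ₗ-map f (i ∷_) (allVecs n k)) ⟩
  ∑[ i ∈ allFin n ] ∑[ w ∈ allVecs n k ] f (i ∷ w)         ≡⟨ ∑ₗ-allFin (λ i → ∑[ w ∈ allVecs n k ] f (i ∷ w)) ⟩
  ∑[ i < n ] ∑[ w ∈ allVecs n k ] f (i ∷ w)                ≡⟨ sum-single _ a (λ i i≢a → off-head i i≢a) ⟩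
  ∑[ w ∈ allVecs n k ] f (a ∷ w)                           ≡⟨ ∑ₗ-allVecs-single k (f ∘ (a ∷_)) x (λ w w≢x → f-vanishes (a ∷ w) (w≢x ∘ cong Vec.tail)) ⟩
  f (a ∷ x)                                                ∎
  where
  open ≡-Reasoning
  off-head : ∀ i → i ≢ a → ∑[ w ∈ allVecs n k ] f (i ∷ w) ≡ 0ℚ
  off-head i i≢a = trans (∑ₗ-cong (allVecs n k) (λ w → f-vanishes (i ∷ w) (i≢a ∘ cong Vec.head))) (∑ₗ-zero (allVecs n k))

∑ₗ-Sym-single : (f : Word n → ℚ) {x : Word n} → isPerm x ≡ true → (∀ w → w ≢ x → f w ≡ 0ℚ) → ∑ₗ (Sym n) f ≡ f x
∑ₗ-Sym-single {n} f {x} x-perm f-vanishes =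
  trans (∑ₗ-filter isPerm f (allVecs n n)) (trans (∑ₗ-allVecs-single n _ x vanishes) at-x)
  where
  vanishes : ∀ w → w ≢ x → (if isPerm w then f w else 0ℚ) ≡ 0ℚ
  vanishes w w≢x with isPerm w
  ... | true  = f-vanishes w w≢x
  ... | false = refl
  at-x : (if isPerm x then f x else 0ℚ) ≡ f x
  at-x rewrite x-perm = refl

module GroupByKey {A : Set} (q : A → Bool) (k : A → ℕ) (m : ℕ) (k≤m : ∀ x → k x ℕ.≤ m) (d : ℕ → ℚ) where

  keyCount : List A → ℕ → ℕ
  keyCount xs s = length (filter (λ x → (q x ∧ ⌊ k x ℕ.≟ s ⌋) Bool.≟ true) xs)

  keyCount-∷ : ∀ x xs s → keyCount (x ∷ xs) s ≡ 𝟙 (q x ∧ ⌊ k x ℕ.≟ s ⌋) ℕ.+ keyCount xs s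
  keyCount-∷ x xs s with q x ∧ ⌊ k x ℕ.≟ s ⌋
  ... | true  = refl
  ... | false = refl

  term-as-sum : ∀ x → (if q x then d (k x) else 0ℚ) ≡ ∑[ j < suc m ] (d (toℕ j) * ℕtoℚ (𝟙 (q x ∧ ⌊ k x ℕ.≟ toℕ j ⌋)))
  term-as-sum x with q x
  ... | false = sym (sum-zero {suc m} (λ j → d (toℕ j) * 0ℚ) (λ j → *-zeroʳ (d (toℕ j))))
  ... | true  = sym (trans (sum-single _ key off-key) at-key)
    where
    key : Fin (suc m)
    key = fromℕ< (s≤s (k≤m x))
    toℕ-key : toℕ key ≡ k x
    toℕ-key = Fin.toℕ-fromℕ< (s≤s (k≤m x))
    off-key : ∀ j → j ≢ key → d (toℕ j) * ℕtoℚ (𝟙 ⌊ k x ℕ.≟ toℕ j ⌋) ≡ 0ℚ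
    off-key j j≢key rewrite ⌊⌋-false (k x ℕ.≟ toℕ j) (λ kx≡j → j≢key (Fin.toℕ-injective (trans (sym kx≡j) (sym toℕ-key)))) = *-zeroʳ (d (toℕ j))
    at-key : d (toℕ key) * ℕtoℚ (𝟙 ⌊ k x ℕ.≟ toℕ key ⌋) ≡ d (k x)
    at-key rewrite ⌊⌋-true (k x ℕ.≟ toℕ key) (sym toℕ-key) | toℕ-key = *-identityʳ (d (k x))

  ∑ₗ-group-by-key : ∀ xs → ∑[ x ∈ xs ] (if q x then d (k x) else 0ℚ) ≡ ∑[ j < suc m ] (d (toℕ j) * ℕtoℚ (keyCount xs (toℕ j)))
  ∑ₗ-group-by-key [] = sym (sum-zero {suc m} (λ j → d (toℕ j) * 0ℚ) (λ j → *-zeroʳ (d (toℕ j))))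
  ∑ₗ-group-by-key (x ∷ xs) = begin
    (if q x then d (k x) else 0ℚ) + ∑[ x ∈ xs ] (if q x then d (k x) else 0ℚ)
      ≡⟨ cong₂ _+_ (term-as-sum x) (∑ₗ-group-by-key xs) ⟩
    ∑[ j < suc m ] (d (toℕ j) * ℕtoℚ (hit j)) + ∑[ j < suc m ] (d (toℕ j) * ℕtoℚ (keyCount xs (toℕ j)))
      ≡⟨ sym (∑-distrib-+ (λ j → d (toℕ j) * ℕtoℚ (hit j)) (λ j → d (toℕ j) * ℕtoℚ (keyCount xs (toℕ j)))) ⟩
    ∑[ j < suc m ] (d (toℕ j) * ℕtoℚ (hit j) + d (toℕ j) * ℕtoℚ (keyCount xs (toℕ j)))
      ≡⟨ sum-cong-≗ {suc m} {λ j → d (toℕ j) * ℕtoℚ (hit j) + d (toℕ j) * ℕtoℚ (keyCount xs (toℕ j))} (λ j → trans (sym (*-distribˡ-+ (d (toℕ j)) _ _)) (cong (d (toℕ j) *_) (sym (trans (cong ℕtoℚ (keyCount-∷ x xs (toℕ j))) (ℕtoℚ-+ (hit j) _))))) ⟩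
    ∑[ j < suc m ] (d (toℕ j) * ℕtoℚ (keyCount (x ∷ xs) (toℕ j))) ∎
    where
    open ≡-Reasoning
    hit : Fin (suc m) → ℕ
    hit j = 𝟙 (q x ∧ ⌊ k x ℕ.≟ toℕ j ⌋)

filter-∈-sublists : {A : Set} (p : A → Bool) (xs : List A) → filter (λ x → p x Bool.≟ true) xs ∈ sublists xs
filter-∈-sublists p []       = here refl
filter-∈-sublists p (x ∷ xs) with p x
... | true  = ∈-++⁺ˡ (∈-map⁺ (x ∷_) (filter-∈-sublists p xs))
... | false = ∈-++⁺ʳ (List.map (x ∷_) (sublists xs)) (filter-∈-sublists p xs)

≤-foldr-⊔ : {A : Set} (f : A → ℚ) {a : A} (as : List A) → a ∈ as → f a ≤ foldr (λ b m → f b ⊔ m) 0ℚ as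
≤-foldr-⊔ f (b ∷ as) (here refl) = p≤p⊔q (f b) _
≤-foldr-⊔ f (b ∷ as) (there a∈) = ≤-trans (≤-foldr-⊔ f as a∈) (p≤q⊔p (f b) _)

𝔼χ : Measure n → ℚ
𝔼χ {n} μ = ∑[ σ ∈ Sym n ] (μ σ * χ σ)

δ : Word n → Measure n
δ x σ = if σ =ₚ x then 1ℚ else 0ℚ

𝔼χ-δ : {x : Word n} → isPerm x ≡ true → 𝔼χ (δ x) ≡ χ x
𝔼χ-δ {x = x} x-perm = trans (∑ₗ-Sym-single (λ σ → δ x σ * χ σ) x-perm vanishes) at-x
  where
  vanishes : ∀ w → w ≢ x → δ x w * χ w ≡ 0ℚ
  vanishes w w≢x rewrite =ₚ-≢ w≢x = *-zeroˡ (χ w)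
  at-x : δ x x * χ x ≡ χ x
  at-x rewrite =ₚ-refl x = *-identityˡ (χ x)

𝔼χ-conv : (μ ν : Measure n) → 𝔼χ (conv μ ν) ≡ 𝔼χ μ * 𝔼χ ν
𝔼χ-conv {n} μ ν = begin
  ∑[ σ ∈ S ] (conv μ ν σ * χ σ)                       ≡⟨ ∑ₗ-cong S (λ σ → cong (_* χ σ) (sumℚ-concatMap (λ α → List.map (λ β → H α β σ) S) S)) ⟩
  ∑[ σ ∈ S ] ((∑[ α ∈ S ] ∑[ β ∈ S ] H α β σ) * χ σ)  ≡⟨ ∑ₗ-cong S (λ σ → trans (sym (∑ₗ-*ʳ (χ σ) _ S)) (∑ₗ-cong S (λ α → sym (∑ₗ-*ʳ (χ σ) (λ β → H α β σ) S)))) ⟩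
  ∑[ σ ∈ S ] ∑[ α ∈ S ] ∑[ β ∈ S ] (H α β σ * χ σ)    ≡⟨ ∑ₗ-comm (λ σ α → ∑[ β ∈ S ] (H α β σ * χ σ)) S S ⟩
  ∑[ α ∈ S ] ∑[ σ ∈ S ] ∑[ β ∈ S ] (H α β σ * χ σ)    ≡⟨ ∑ₗ-cong S (λ α → ∑ₗ-comm (λ σ β → H α β σ * χ σ) S S) ⟩
  ∑[ α ∈ S ] ∑[ β ∈ S ] ∑[ σ ∈ S ] (H α β σ * χ σ)    ≡⟨ ∑ₗ-cong-∈ S (λ α∈ → ∑ₗ-cong-∈ S (λ β∈ → at-product (∈-Sym⇒isPerm α∈) (∈-Sym⇒isPerm β∈))) ⟩
  ∑[ α ∈ S ] ∑[ β ∈ S ] ((μ α * χ α) * (ν β * χ β))   ≡⟨ ∑ₗ-cong S (λ α → ∑ₗ-*ˡ (μ α * χ α) (λ β → ν β * χ β) S) ⟩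
  ∑[ α ∈ S ] ((μ α * χ α) * 𝔼χ ν)                     ≡⟨ ∑ₗ-*ʳ (𝔼χ ν) (λ α → μ α * χ α) S ⟩
  𝔼χ μ * 𝔼χ ν                                         ∎
  where
  open ≡-Reasoning
  S = Sym n
  H : Word n → Word n → Word n → ℚ
  H α β σ = if (α ∘ₚ β) =ₚ σ then μ α * ν β else 0ℚ
  at-product : ∀ {α β} → isPerm α ≡ true → isPerm β ≡ true → ∑[ σ ∈ S ] (H α β σ * χ σ) ≡ (μ α * χ α) * (ν β * χ β)
  at-product {α} {β} α-perm β-perm = begin
    ∑[ σ ∈ S ] (H α β σ * χ σ)       ≡⟨ ∑ₗ-Sym-single (λ σ → H α β σ * χ σ) (isPerm-∘ₚ {α = α} {β} α-perm β-perm) vanishes ⟩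
    H α β (α ∘ₚ β) * χ (α ∘ₚ β)      ≡⟨ cong₂ _*_ (cong (λ b → if b then μ α * ν β else 0ℚ) (=ₚ-refl (α ∘ₚ β))) (χ-∘ₚ {α = α} {β} α-perm β-perm) ⟩
    (μ α * ν β) * (χ α * χ β)        ≡⟨ solve 4 (λ a b c d → (a :* b) :* (c :* d) := (a :* c) :* (b :* d)) refl (μ α) (ν β) (χ α) (χ β) ⟩
    (μ α * χ α) * (ν β * χ β)        ∎
    where
    vanishes : ∀ σ → σ ≢ α ∘ₚ β → H α β σ * χ σ ≡ 0ℚ
    vanishes σ σ≢αβ rewrite =ₚ-≢ (σ≢αβ ∘ sym) = *-zeroˡ (χ σ)

𝔼χ-convPow : (μ : Measure n) → ∀ t → 𝔼χ (convPow μ t) ≡ 𝔼χ μ ^ℚ t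
𝔼χ-convPow {n} μ zero    = trans (𝔼χ-δ {x = idPerm {n}} (pairingPerm-perm {n} 0)) (χ-id {n})
𝔼χ-convPow     μ (suc t) = trans (𝔼χ-conv (convPow μ t) μ) (trans (cong (_* 𝔼χ μ) (𝔼χ-convPow μ t)) (*-comm _ (𝔼χ μ)))

∘ₚ-cancel-involution : {τ : Word n} → isInvolution τ ≡ true → (β : Word n) → τ ∘ₚ (τ ∘ₚ β) ≡ β
∘ₚ-cancel-involution {τ = τ} τ-invol β = trans (tabulate-cong cancel) (tabulate∘lookup β)
  where
  cancel : ∀ i → lookup τ (lookup (τ ∘ₚ β) i) ≡ lookup β i
  cancel i = trans (cong (lookup τ) (lookup-∘ₚ τ β i)) (isInvolution⇒involutive {σ = τ} τ-invol (lookup β i))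

counting : Measure n
counting _ = 1ℚ

conv-δ-counting : {τ σ : Word n} → isPerm τ ≡ true → isInvolution τ ≡ true → isPerm σ ≡ true → conv (δ τ) counting σ ≡ 1ℚ
conv-δ-counting {n} {τ} {σ} τ-perm τ-invol σ-perm = begin
  conv (δ τ) counting σ                  ≡⟨ sumℚ-concatMap (λ α → List.map (H α) (Sym n)) (Sym n) ⟩
  ∑[ α ∈ Sym n ] ∑[ β ∈ Sym n ] H α β    ≡⟨ ∑ₗ-Sym-single (λ α → ∑[ β ∈ Sym n ] H α β) τ-perm off-τ ⟩
  ∑[ β ∈ Sym n ] H τ β                   ≡⟨ ∑ₗ-Sym-single (H τ) (isPerm-∘ₚ {α = τ} {σ} τ-perm σ-perm) off-τσ ⟩
  H τ (τ ∘ₚ σ)                           ≡⟨ cong₂ (λ b c → if b then (if c then 1ℚ else 0ℚ) * 1ℚ else 0ℚ) (=ₚ-true (∘ₚ-cancel-involution {τ = τ} τ-invol σ)) (=ₚ-refl τ) ⟩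
  1ℚ                                     ∎
  where
  open ≡-Reasoning
  H : Word n → Word n → ℚ
  H α β = if (α ∘ₚ β) =ₚ σ then δ τ α * 1ℚ else 0ℚ
  =ₚ-true : ∀ {α β : Word n} → α ≡ β → (α =ₚ β) ≡ true
  =ₚ-true refl = =ₚ-refl _
  off-τ : ∀ α → α ≢ τ → ∑[ β ∈ Sym n ] H α β ≡ 0ℚ
  off-τ α α≢τ = trans (∑ₗ-cong (Sym n) vanish) (∑ₗ-zero (Sym n))
    where
    vanish : ∀ β → H α β ≡ 0ℚ
    vanish β rewrite =ₚ-≢ α≢τ with (α ∘ₚ β) =ₚ σ
    ... | true  = refl
    ... | false = refl
  off-τσ : ∀ β → β ≢ τ ∘ₚ σ → H τ β ≡ 0ℚ
  off-τσ β β≢τσ rewrite =ₚ-≢ {u = τ ∘ₚ β} {σ} (λ τβ≡σ → β≢τσ (trans (sym (∘ₚ-cancel-involution {τ = τ} τ-invol β)) (cong (τ ∘ₚ_) τβ≡σ))) = refl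

-- Convolving with δ τ for a transposition τ fixes the counting measure and multiplies 𝔼χ by −1.
𝔼χ-counting : 2 ℕ.≤ n → 𝔼χ (counting {n}) ≡ 0ℚ
𝔼χ-counting {n} 2≤n = x≡-x⇒x≡0 (begin
  c                         ≡⟨ ∑ₗ-cong-∈ (Sym n) τ-invariant ⟩
  𝔼χ (conv (δ τ) counting)  ≡⟨ 𝔼χ-conv (δ τ) counting ⟩
  𝔼χ (δ τ) * c              ≡⟨ cong (_* c) (trans (𝔼χ-δ {x = τ} τ-perm) (χ-pairingPerm 1 2≤n)) ⟩
  - 1ℚ * c                  ≡⟨ solve 1 (λ x → :- con 1ℚ :* x := :- x) refl c ⟩
  - c                       ∎)
  where
  open ≡-Reasoning
  c = 𝔼χ (counting {n})
  τ : Word n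
  τ = pairingPerm 1
  τ-perm = pairingPerm-perm {n} 1
  τ-invol = pairingPerm-involution {n} 1
  τ-invariant : ∀ {σ} → σ ∈ Sym n → counting σ * χ σ ≡ conv (δ τ) counting σ * χ σ
  τ-invariant {σ} σ∈ = cong (_* χ σ) (sym (conv-δ-counting {τ = τ} τ-perm τ-invol (∈-Sym⇒isPerm σ∈)))

𝔼χ-uniform : 2 ℕ.≤ n → 𝔼χ (uniform {n}) ≡ 0ℚ
𝔼χ-uniform {n} 2≤n = begin
  ∑[ σ ∈ Sym n ] (recipℕ (n !) * χ σ)          ≡⟨ ∑ₗ-cong (Sym n) (λ σ → cong (recipℕ (n !) *_) (sym (*-identityˡ (χ σ)))) ⟩
  ∑[ σ ∈ Sym n ] (recipℕ (n !) * (1ℚ * χ σ))   ≡⟨ ∑ₗ-*ˡ (recipℕ (n !)) (λ σ → 1ℚ * χ σ) (Sym n) ⟩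
  recipℕ (n !) * 𝔼χ (counting {n})             ≡⟨ cong (recipℕ (n !) *_) (𝔼χ-counting 2≤n) ⟩
  recipℕ (n !) * 0ℚ                            ≡⟨ *-zeroʳ (recipℕ (n !)) ⟩
  0ℚ                                           ∎
  where open ≡-Reasoning

𝔼χ-involutionWalk : ∀ n p → 𝔼χ (involutionWalk n p) ≡ (- (1ℚ - p) + p) ^ℚ (n ℕ./ 2)
𝔼χ-involutionWalk n p = begin
  ∑[ σ ∈ Sym n ] (involutionWalk n p σ * χ σ)                       ≡⟨ ∑ₗ-cong-∈ (Sym n) (λ {σ} _ → signed-weight σ) ⟩
  ∑[ σ ∈ Sym n ] (if isInvolution σ then d (twoCycles σ) else 0ℚ)   ≡⟨ GroupByKey.∑ₗ-group-by-key isInvolution twoCycles m twoCycles≤n/2 d (Sym n) ⟩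
  ∑[ j < suc m ] (d (toℕ j) * ℕtoℚ (classSize n (toℕ j)))           ≡⟨ sum-cong-≗ {suc m} (λ j → class-total (toℕ j) (ℕ.≤-pred (Fin.toℕ<n j))) ⟩
  ∑[ j < suc m ] (ℕtoℚ (m C toℕ j) * ((- (1ℚ - p)) ^ℚ toℕ j * p ^ℚ (m ∸ toℕ j)))  ≡⟨ sym (binomial m (- (1ℚ - p)) p) ⟩
  (- (1ℚ - p) + p) ^ℚ m                                             ∎
  where
  open ≡-Reasoning
  m = n ℕ./ 2
  weight : ℕ → ℚ
  weight s = ℕtoℚ (m C s) * (p ^ℚ (m ∸ s)) * ((1ℚ - p) ^ℚ s) * recipℕ (classSize n s)
  d : ℕ → ℚ
  d s = weight s * sgn s
  signed-weight : ∀ σ → involutionWalk n p σ * χ σ ≡ (if isInvolution σ then d (twoCycles σ) else 0ℚ)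
  signed-weight σ = by-cases (isInvolution σ) refl
    where
    by-cases : ∀ b → isInvolution σ ≡ b → (if b then weight (twoCycles σ) else 0ℚ) * χ σ ≡ (if b then d (twoCycles σ) else 0ℚ)
    by-cases true  σ-invol = cong (weight (twoCycles σ) *_) (χ-involution {σ = σ} σ-invol)
    by-cases false _       = *-zeroˡ (χ σ)
  class-total : ∀ s → s ℕ.≤ m → d s * ℕtoℚ (classSize n s) ≡ ℕtoℚ (m C s) * ((- (1ℚ - p)) ^ℚ s * p ^ℚ (m ∸ s))
  class-total s s≤m = cancel (classSize n s) (classSize-nonZero {n} s 2s≤n)
    where
    2s≤n = ℕ.≤-trans (ℕ.*-monoʳ-≤ 2 s≤m) (ℕ.≤-trans (ℕ.≤-reflexive (ℕ.*-comm 2 m)) (ℕ.m/n*n≤m n 2))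
    binom = ℕtoℚ (m C s)
    q^ = p ^ℚ (m ∸ s)
    r^ = (1ℚ - p) ^ℚ s
    cancel : ∀ N → ∃ (λ c → N ≡ suc c) → binom * q^ * r^ * recipℕ N * sgn s * ℕtoℚ N ≡ binom * ((- (1ℚ - p)) ^ℚ s * q^)
    cancel _ (c , refl) = begin
      binom * q^ * r^ * recipℕ (suc c) * sgn s * ℕtoℚ (suc c)
        ≡⟨ solve 6 (λ a b c r g k → a :* b :* c :* r :* g :* k := a :* (g :* c :* b) :* (r :* k)) refl binom q^ r^ (recipℕ (suc c)) (sgn s) (ℕtoℚ (suc c)) ⟩
      binom * (sgn s * r^ * q^) * (recipℕ (suc c) * ℕtoℚ (suc c))
        ≡⟨ cong (binom * (sgn s * r^ * q^) *_) (recipℕ-inverse c) ⟩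
      binom * (sgn s * r^ * q^) * 1ℚ
        ≡⟨ *-identityʳ _ ⟩
      binom * (sgn s * r^ * q^)
        ≡⟨ cong (λ z → binom * (z * q^)) (sym (^ℚ-neg (1ℚ - p) s)) ⟩
      binom * ((- (1ℚ - p)) ^ℚ s * q^) ∎

𝔼χ-walk-power : ∀ n p {t} → 2 ∣ t → 𝔼χ (convPow (involutionWalk n p) t) ≡ (1ℚ - ℕtoℚ 2 * p) ^ℚ (t ℕ.* (n ℕ./ 2))
𝔼χ-walk-power n p {t} 2∣t = begin
  𝔼χ (convPow (involutionWalk n p) t)     ≡⟨ 𝔼χ-convPow (involutionWalk n p) t ⟩
  𝔼χ (involutionWalk n p) ^ℚ t            ≡⟨ cong (_^ℚ t) (𝔼χ-involutionWalk n p) ⟩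
  ((- (1ℚ - p) + p) ^ℚ m) ^ℚ t            ≡⟨ cong (λ x → (x ^ℚ m) ^ℚ t) (solve 1 (λ p → :- (con 1ℚ :- p) :+ p := :- (con 1ℚ :- con (ℕtoℚ 2) :* p)) refl p) ⟩
  ((- c) ^ℚ m) ^ℚ t                       ≡⟨ ^ℚ-* (- c) m t ⟩
  (- c) ^ℚ (m ℕ.* t)                      ≡⟨ ^ℚ-neg-even c (∣n⇒∣m*n m 2∣t) ⟩
  c ^ℚ (m ℕ.* t)                          ≡⟨ cong (c ^ℚ_) (ℕ.*-comm m t) ⟩
  c ^ℚ (t ℕ.* m)                          ∎
  where
  open ≡-Reasoning
  m = n ℕ./ 2
  c = 1ℚ - ℕtoℚ 2 * p

mass-≤-tv : (μ ν : Measure n) {A : List (Word n)} → A ∈ sublists (Sym n) → ∣ mass μ A - mass ν A ∣ ≤ tv μ ν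
mass-≤-tv μ ν A∈ = ≤-foldr-⊔ (λ B → ∣ mass μ B - mass ν B ∣) _ A∈

module _ {n : ℕ} where

  even odd : Word n → Bool
  even σ = isEven (inversions (lookup σ))
  odd σ = not (even σ)

  evens odds : List (Word n)
  evens = filter (λ σ → even σ Bool.≟ true) (Sym n)
  odds = filter (λ σ → odd σ Bool.≟ true) (Sym n)

  mass-evens-odds : (μ : Measure n) → mass μ evens - mass μ odds ≡ 𝔼χ μ
  mass-evens-odds μ = begin
    mass μ evens - mass μ odds
      ≡⟨ cong₂ _-_ (∑ₗ-filter even μ (Sym n)) (∑ₗ-filter odd μ (Sym n)) ⟩
    ∑[ σ ∈ Sym n ] (if even σ then μ σ else 0ℚ) - ∑[ σ ∈ Sym n ] (if odd σ then μ σ else 0ℚ)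
      ≡⟨ cong (λ z → ∑[ σ ∈ Sym n ] (if even σ then μ σ else 0ℚ) + z) (trans (solve 1 (λ s → :- s := :- con 1ℚ :* s) refl _) (sym (∑ₗ-*ˡ (- 1ℚ) (λ σ → if odd σ then μ σ else 0ℚ) (Sym n)))) ⟩
    ∑[ σ ∈ Sym n ] (if even σ then μ σ else 0ℚ) + ∑[ σ ∈ Sym n ] (- 1ℚ * (if odd σ then μ σ else 0ℚ))
      ≡⟨ sym (∑ₗ-distrib-+ (Sym n)) ⟩
    ∑[ σ ∈ Sym n ] ((if even σ then μ σ else 0ℚ) + - 1ℚ * (if odd σ then μ σ else 0ℚ))
      ≡⟨ ∑ₗ-cong (Sym n) signed ⟩
    𝔼χ μ ∎
    where
    open ≡-Reasoning
    signed : ∀ σ → (if even σ then μ σ else 0ℚ) + - 1ℚ * (if odd σ then μ σ else 0ℚ) ≡ μ σ * χ σ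
    signed σ rewrite sgn≡±1 (inversions (lookup σ)) with even σ
    ... | true  = solve 1 (λ x → x :+ :- con 1ℚ :* con 0ℚ := x :* con 1ℚ) refl (μ σ)
    ... | false = solve 1 (λ x → con 0ℚ :+ :- con 1ℚ :* x := x :* :- con 1ℚ) refl (μ σ)

  -- Bounding x − y by |x| + |y|, rather than using y = −x, avoids needing μ to have total mass 1.
  ½𝔼χ≤tv : 2 ℕ.≤ n → (μ : Measure n) → ½ * 𝔼χ μ ≤ tv μ uniform
  ½𝔼χ≤tv 2≤n μ = begin
    ½ * 𝔼χ μ          ≡⟨ cong (½ *_) (sym x-y≡𝔼χ) ⟩
    ½ * (x - y)       ≤⟨ *-monoˡ-≤-nonNeg ½ (≤-trans (p≤∣p∣ (x - y)) (∣p-q∣≤∣p∣+∣q∣ x y)) ⟩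
    ½ * (∣ x ∣ + ∣ y ∣) ≤⟨ *-monoˡ-≤-nonNeg ½ (+-mono-≤ (mass-≤-tv μ U (filter-∈-sublists even (Sym n))) (mass-≤-tv μ U (filter-∈-sublists odd (Sym n)))) ⟩
    ½ * (D + D)       ≡⟨ solve 1 (λ t → con ½ :* (t :+ t) := t) refl D ⟩
    D                 ∎
    where
    open ≤-Reasoning
    U = uniform {n}
    D = tv μ U
    x = mass μ evens - mass U evens
    y = mass μ odds - mass U odds
    x-y≡𝔼χ : x - y ≡ 𝔼χ μ
    x-y≡𝔼χ = begin-equality
      x - y
        ≡⟨ solve 4 (λ a b c d → (a :- c) :- (b :- d) := (a :- b) :- (c :- d)) refl (mass μ evens) (mass μ odds) (mass U evens) (mass U odds) ⟩
      (mass μ evens - mass μ odds) - (mass U evens - mass U odds)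
        ≡⟨ cong₂ _-_ (mass-evens-odds μ) (mass-evens-odds U) ⟩
      𝔼χ μ - 𝔼χ U
        ≡⟨ cong (λ z → 𝔼χ μ - z) (𝔼χ-uniform 2≤n) ⟩
      𝔼χ μ - 0ℚ
        ≡⟨ solve 1 (λ a → a :- con 0ℚ := a) refl (𝔼χ μ) ⟩
      𝔼χ μ ∎

open import Data.Integer using (+_)

½-recipℕ≤½[1-2p]^tm : ∀ n {p} t → 0 ℕ.< n → 0ℚ ≤ p → p ≤ + 1 / 4 → ℕtoℚ t * (ℕtoℚ (n ℕ.* n) * p) ≤ 1ℚ →
                      ½ - recipℕ n ≤ ½ * (1ℚ - ℕtoℚ 2 * p) ^ℚ (t ℕ.* (n ℕ./ 2))
½-recipℕ≤½[1-2p]^tm n@(suc n′) {p} t _ 0≤p p≤¼ tn²p≤1 = begin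
  ½ - recipℕ n                    ≤⟨ +-monoʳ-≤ ½ (neg-antimono-≤ (≤-recipℕ {X} n′ XN≤1)) ⟩
  ½ - X                           ≡⟨ solve 2 (λ x p → con ½ :- x :* p := con ½ :* (con 1ℚ :- x :* (con (ℕtoℚ 2) :* p))) refl (ℕtoℚ tm) p ⟩
  ½ * (1ℚ - ℕtoℚ tm * a)          ≤⟨ *-monoˡ-≤-nonNeg ½ (bernoulli 0≤a a≤1 tm) ⟩
  ½ * (1ℚ - a) ^ℚ tm              ∎
  where
  open ≤-Reasoning
  tm = t ℕ.* (n ℕ./ 2)
  X = ℕtoℚ tm * p
  N = ℕtoℚ n
  a = ℕtoℚ 2 * p
  0≤a : 0ℚ ≤ a
  0≤a = *-nonNeg (ℕtoℚ-nonNeg 2) 0≤p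
  a≤1 : a ≤ 1ℚ
  a≤1 = ≤-trans (*-monoˡ-≤-nonNeg (ℕtoℚ 2) p≤¼) (toWitness {a? = ℕtoℚ 2 * (+ 1 / 4) ≤? 1ℚ} _)
  XN≤1 : X * N ≤ 1ℚ
  XN≤1 = begin
    ℕtoℚ tm * p * N                          ≡⟨ cong (λ z → z * p * N) (ℕtoℚ-* t (n ℕ./ 2)) ⟩
    ℕtoℚ t * ℕtoℚ (n ℕ./ 2) * p * N          ≡⟨ solve 4 (λ t m p n → t :* m :* p :* n := t :* p :* n :* m) refl (ℕtoℚ t) (ℕtoℚ (n ℕ./ 2)) p N ⟩
    ℕtoℚ t * p * N * ℕtoℚ (n ℕ./ 2)          ≤⟨ *-monoˡ-≤-nonNeg (ℕtoℚ t * p * N) {{nonNegative (*-nonNeg (*-nonNeg (ℕtoℚ-nonNeg t) 0≤p) (ℕtoℚ-nonNeg n))}} (ℕtoℚ-mono-≤ (ℕ.m/n≤m n 2)) ⟩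
    ℕtoℚ t * p * N * N                       ≡⟨ solve 3 (λ t p n → t :* p :* n :* n := t :* ((n :* n) :* p)) refl (ℕtoℚ t) p N ⟩
    ℕtoℚ t * ((N * N) * p)                   ≡⟨ cong (λ z → ℕtoℚ t * (z * p)) (sym (ℕtoℚ-* n n)) ⟩
    ℕtoℚ t * (ℕtoℚ (n ℕ.* n) * p)            ≤⟨ tn²p≤1 ⟩
    1ℚ                                       ∎

mainTheorem13 : (n : ℕ) → 0 ℕ.< n → 2 ∣ n → (p : ℚ) → 0ℚ ≤ p → p ≤ 1ℚ → (t : ℕ) → 2 ∣ t →
    (½ * ((1ℚ - ℕtoℚ 2 * p) ^ℚ (t ℕ.* (n ℕ./ 2))) ≤ tv (convPow (involutionWalk n p) t) uniform)
    × (0ℚ < p → p ≤ + 1 / 4 → ℕtoℚ t * (ℕtoℚ (n ℕ.* n) * p) ≤ 1ℚ →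
       ½ - recipℕ n ≤ tv (convPow (involutionWalk n p) t) uniform)
mainTheorem13 n 0<n 2∣n p 0≤p _ t 2∣t = sign-bound , small-p-bound
  where
  μ = convPow (involutionWalk n p) t
  sign-bound : ½ * (1ℚ - ℕtoℚ 2 * p) ^ℚ (t ℕ.* (n ℕ./ 2)) ≤ tv μ uniform
  sign-bound = subst (λ x → ½ * x ≤ tv μ uniform) (𝔼χ-walk-power n p 2∣t) (½𝔼χ≤tv (∣⇒≤ {{ℕ.>-nonZero 0<n}} 2∣n) μ)
  small-p-bound : 0ℚ < p → p ≤ + 1 / 4 → ℕtoℚ t * (ℕtoℚ (n ℕ.* n) * p) ≤ 1ℚ → ½ - recipℕ n ≤ tv μ uniform
  small-p-bound _ p≤¼ tn²p≤1 = ≤-trans (½-recipℕ≤½[1-2p]^tm n t 0<n 0≤p p≤¼ tn²p≤1) sign-bound
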